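{- Let $n\in\mathbb{N}_0$ and let $a,c,e$ be complex parameters such that all denominators below are nonzero. Then \[\frac{(a;q)_n(c;q)_n}{(ae;q)_n(qc/e;q)_n} =\sum_{k\ge0}\binom{n}{2k}_q\frac{(1-q^{ -k}e/c)\,q^{(1+2k)(k-n)}}{(q^{1-n}/ae;q)_k\,(q^{ -n}e/c;q)_{k+1}}\, \frac{(e;q)_k(ae/c;q)_k}{(ae;q)_k}\,\frac{(q/e;q)_k(qc/ae;q)_k}{(qc/e;q)_k}\] \[-\sum_{k\ge0}\binom{n}{2k+1}_q\frac{(1-q^{ -k}/ae)\,q^{(1+k)(1+2k-2n)}}{(q^{1-n}/ae;q)_{k+1}\,(q^{ -n}e/c;q)_{k+1}}\, \frac{(e;q)_{k+1}(ae/c;q)_{k+1}}{(ae;q)_{k+1}}\,\frac{(q/e;q)_k(qc/ae;q)_k}{(qc/e;q)_k}.\]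
   Context: For an indeterminate $x$ and $n\in\mathbb{N}_0$, $(x;q)_0=1$ and $(x;q)_n=(1-x)(1-qx)\cdots(1-q^{n-1}x)$. The Gaussian binomial coefficient is $\binom{m}{j}_q=\frac{(q;q)_m}{(q;q)_j(q;q)_{m-j}}$ for $0\le j\le m$ and $\binom{m}{j}_q=0$ for $j>m$ (so the sums are finite). -}

module Defs where

open import Level using (Level; _⊔_) renaming (suc to lsuc)
open import Algebra.Bundles using (CommutativeRing)
open import Data.Nat as ℕ using (ℕ; zero; suc)
open import Data.Integer as ℤ using (ℤ; +_; -[1+_])
open import Relation.Nullary using (¬_)

-- A field: a commutative ring with 0 ≠ 1 in which every nonzero element
-- has a multiplicative inverse.  (_⁻¹ is total; its value at 0 is junk
-- and is never relevant under the nonvanishing hypotheses.)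
record Field (c ℓ : Level) : Set (lsuc (c ⊔ ℓ)) where
  field
    commutativeRing : CommutativeRing c ℓ
  open CommutativeRing commutativeRing public
  field
    _⁻¹        : Carrier → Carrier
    ⁻¹-inverse : ∀ x → ¬ (x ≈ 0#) → x * (x ⁻¹) ≈ 1#
    0≉1        : ¬ (0# ≈ 1#)

module FieldOps {c ℓ : Level} (F : Field c ℓ) where
  open Field F

  infixl 7 _/_
  _/_ : Carrier → Carrier → Carrier
  x / y = x * (y ⁻¹)

  pow : Carrier → ℕ → Carrier
  pow x zero    = 1#
  pow x (suc n) = x * pow x n

  zpow : Carrier → ℤ → Carrier
  zpow x (+ n)      = pow x n
  zpow x -[1+ n ]   = pow (x ⁻¹) (suc n)

  poch : Carrier → Carrier → ℕ → Carrier
  poch q x zero    = 1#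
  poch q x (suc n) = poch q x n * (1# - pow q n * x)

  -- Gaussian binomial coefficient [m choose j]_q, as the polynomial in q
  -- given by the q-Pascal rule; it equals (q;q)_m / ((q;q)_j (q;q)_{m-j})
  -- for j ≤ m and is 0 for j > m.
  gauss : Carrier → ℕ → ℕ → Carrier
  gauss q m       zero    = 1#
  gauss q zero    (suc j) = 0#
  gauss q (suc m) (suc j) = gauss q m j + pow q (suc j) * gauss q m (suc j)

  sumTo : ℕ → (ℕ → Carrier) → Carrier
  sumTo zero    f = 0#
  sumTo (suc n) f = sumTo n f + f n

-- Put x = ae, y = c/e and w = ae/c, so that a = wy and c = ey.  In any commutative ring
--   (wy;q)ₙ (ey;q)ₙ = Σⱼ [n j]_q Fₙ(j),
--   Fₙ(2k)   = q^{k(k-1)} y^{2k}   (e;q)ₖ   (w;q)ₖ   ρₑ(k) ρ_w(k) (qᵏx;q)_{n-2k}   (qᵏy;q)_{n-2k},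
--   Fₙ(2k+1) = q^{k²}     y^{2k+1} (e;q)ₖ₊₁ (w;q)ₖ₊₁ ρₑ(k) ρ_w(k) (qᵏx;q)_{n-2k-1} (qᵏ⁺¹y;q)_{n-2k-1},
-- where ρ_z(k) = (z - q)⋯(z - qᵏ) = zᵏ (q/z;q)ₖ.  This is proved by induction on n: after the
-- q-Pascal rule, Fₙ₊₁(j+1) + qʲ Fₙ₊₁(j) equals (1 - qⁿa)(1 - qⁿc) Fₙ(j) plus a remainder whose
-- [n j]_q-weighted sum telescopes, because [n j]_q (1 - q^{n-j}) = [n j+1]_q (1 - q^{j+1}).
-- Dividing by (x;q)ₙ (qy;q)ₙ, splitting (x;q)ₙ = (x;q)ₖ (qᵏx;q)_{n-2k} (q^{n-k}x;q)ₖ, and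
-- reversing (q^{n-k}x;q)ₖ into a multiple of (q^{1-n}/x;q)ₖ (likewise for y, and for the
-- odd terms) turns the terms of the expansion into the summands of the two sums.

module Submission where

open import Defs
open import Level using (Level)
open import Algebra.Bundles using (CommutativeRing)
open import Algebra.Solver.Ring.AlmostCommutativeRing
  using (fromCommutativeRing; _-Raw-AlmostCommutative⟶_)
open import Data.Nat as ℕ using (ℕ; zero; suc; _≤_; _<_; _∸_; s≤s; ⌊_/2⌋; ⌈_/2⌉)
import Data.Nat.Properties as ℕ
open import Data.Integer as ℤ using (ℤ; +_; -[1+_]; _⊖_)
import Data.Integer.Properties as ℤ
import Data.Nat.Tactic.RingSolver as ℕ-solve
import Data.Integer.Tactic.RingSolver as ℤ-solve
open import Data.Sign as Sign using (Sign)
open import Data.List using (_∷_; [])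
open import Data.Maybe using (Maybe; just; nothing)
open import Data.Product using (_×_; _,_)
open import Relation.Nullary using (¬_; yes; no)
open import Relation.Binary.PropositionalEquality as ≡ using (_≡_)

-- The library's ring solver, with integer coefficients so that identities involving
-- cancellation (such as x - x ≈ 0) are decided.
module IntegerCoefficients {c ℓ : Level} (R : CommutativeRing c ℓ) where
  open CommutativeRing R
  open import Algebra.Properties.Monoid.Mult.TCOptimised +-monoid using (1+×; ×-homo-+) renaming (_×_ to _·_)
  open import Algebra.Properties.Semiring.Mult.TCOptimised semiring using (×1-homo-*)
  open import Algebra.Properties.Ring ring using (-‿involutive; -‿distribˡ-*; -0#≈0#; -‿+-comm)
  open import Algebra.Properties.CommutativeSemigroup +-commutativeSemigroup using (interchange)
  open import Relation.Binary.Reasoning.Setoid setoid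

  ⟦_⟧ℕ : ℕ → Carrier
  ⟦ n ⟧ℕ = n · 1#

  ⟦_⟧ℤ : ℤ → Carrier
  ⟦ + n ⟧ℤ     = ⟦ n ⟧ℕ
  ⟦ -[1+ n ] ⟧ℤ = - ⟦ suc n ⟧ℕ

  ⟦⊖⟧ : ∀ m n → ⟦ m ⊖ n ⟧ℤ ≈ ⟦ m ⟧ℕ - ⟦ n ⟧ℕ
  ⟦⊖⟧ m zero = begin
    ⟦ m ⊖ 0 ⟧ℤ ≡⟨ ≡.cong ⟦_⟧ℤ (ℤ.⊖-≥ {m} ℕ.z≤n) ⟩
    ⟦ m ⟧ℕ ≈⟨ +-identityʳ _ ⟨
    ⟦ m ⟧ℕ + 0# ≈⟨ +-congˡ -0#≈0# ⟨
    ⟦ m ⟧ℕ - 0# ∎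
  ⟦⊖⟧ zero (suc n) = sym (+-identityˡ _)
  ⟦⊖⟧ (suc m) (suc n) = begin
    ⟦ suc m ⊖ suc n ⟧ℤ ≡⟨ ≡.cong ⟦_⟧ℤ (ℤ.[1+m]⊖[1+n]≡m⊖n m n) ⟩
    ⟦ m ⊖ n ⟧ℤ ≈⟨ ⟦⊖⟧ m n ⟩
    ⟦ m ⟧ℕ - ⟦ n ⟧ℕ ≈⟨ +-identityˡ _ ⟨
    0# + (⟦ m ⟧ℕ - ⟦ n ⟧ℕ) ≈⟨ +-congʳ (-‿inverseʳ 1#) ⟨
    (1# - 1#) + (⟦ m ⟧ℕ - ⟦ n ⟧ℕ) ≈⟨ interchange _ _ _ _ ⟩
    (1# + ⟦ m ⟧ℕ) + (- 1# - ⟦ n ⟧ℕ) ≈⟨ +-congˡ (-‿+-comm 1# _) ⟩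
    (1# + ⟦ m ⟧ℕ) - (1# + ⟦ n ⟧ℕ) ≈⟨ +-cong (1+× m 1#) (-‿cong (1+× n 1#)) ⟨
    ⟦ suc m ⟧ℕ - ⟦ suc n ⟧ℕ ∎

  ⟦+⟧ : ∀ i j → ⟦ i ℤ.+ j ⟧ℤ ≈ ⟦ i ⟧ℤ + ⟦ j ⟧ℤ
  ⟦+⟧ -[1+ m ] -[1+ n ] = begin
    - ⟦ suc (suc (m ℕ.+ n)) ⟧ℕ ≡⟨ ≡.cong (λ k → - ⟦ suc k ⟧ℕ) (ℕ.+-suc m n) ⟨
    - ⟦ suc m ℕ.+ suc n ⟧ℕ ≈⟨ -‿cong (×-homo-+ 1# (suc m) (suc n)) ⟩
    - (⟦ suc m ⟧ℕ + ⟦ suc n ⟧ℕ) ≈⟨ -‿+-comm _ _ ⟨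
    - ⟦ suc m ⟧ℕ - ⟦ suc n ⟧ℕ ∎
  ⟦+⟧ -[1+ m ] (+ n) = trans (⟦⊖⟧ n (suc m)) (+-comm _ _)
  ⟦+⟧ (+ m) -[1+ n ] = ⟦⊖⟧ m (suc n)
  ⟦+⟧ (+ m) (+ n) = ×-homo-+ 1# m n

  ⟦-⟧ : ∀ i → ⟦ ℤ.- i ⟧ℤ ≈ - ⟦ i ⟧ℤ
  ⟦-⟧ -[1+ n ]   = sym (-‿involutive _)
  ⟦-⟧ (+ zero)   = sym -0#≈0#
  ⟦-⟧ (+ suc n)  = refl

  ⟦_⟧± : Sign → Carrier
  ⟦ Sign.+ ⟧± = 1#
  ⟦ Sign.- ⟧± = - 1#

  ⟦◃⟧ : ∀ s n → ⟦ s ℤ.◃ n ⟧ℤ ≈ ⟦ s ⟧± * ⟦ n ⟧ℕ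
  ⟦◃⟧ s      zero    = sym (zeroʳ _)
  ⟦◃⟧ Sign.+ (suc n) = sym (*-identityˡ _)
  ⟦◃⟧ Sign.- (suc n) = trans (-‿cong (sym (*-identityˡ _))) (-‿distribˡ-* 1# _)

  ⟦±⟧ : ∀ s t → ⟦ s Sign.* t ⟧± ≈ ⟦ s ⟧± * ⟦ t ⟧±
  ⟦±⟧ Sign.- Sign.- = sym (trans (sym (-‿distribˡ-* 1# (- 1#))) (trans (-‿cong (*-identityˡ _)) (-‿involutive 1#)))
  ⟦±⟧ Sign.- Sign.+ = sym (*-identityʳ _)
  ⟦±⟧ Sign.+ t      = sym (*-identityˡ _)

  ⟦⟧-signAbs : ∀ i → ⟦ i ⟧ℤ ≈ ⟦ ℤ.sign i ⟧± * ⟦ ℤ.∣ i ∣ ⟧ℕ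
  ⟦⟧-signAbs (+ n)     = sym (*-identityˡ _)
  ⟦⟧-signAbs -[1+ n ] = trans (-‿cong (sym (*-identityˡ _))) (-‿distribˡ-* 1# _)

  ⟦*⟧ : ∀ i j → ⟦ i ℤ.* j ⟧ℤ ≈ ⟦ i ⟧ℤ * ⟦ j ⟧ℤ
  ⟦*⟧ i j = begin
    ⟦ ℤ.sign i Sign.* ℤ.sign j ℤ.◃ ℤ.∣ i ∣ ℕ.* ℤ.∣ j ∣ ⟧ℤ ≈⟨ ⟦◃⟧ (ℤ.sign i Sign.* ℤ.sign j) (ℤ.∣ i ∣ ℕ.* ℤ.∣ j ∣) ⟩
    ⟦ ℤ.sign i Sign.* ℤ.sign j ⟧± * ⟦ ℤ.∣ i ∣ ℕ.* ℤ.∣ j ∣ ⟧ℕ ≈⟨ *-cong (⟦±⟧ (ℤ.sign i) (ℤ.sign j)) (×1-homo-* ℤ.∣ i ∣ ℤ.∣ j ∣) ⟩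
    (⟦ ℤ.sign i ⟧± * ⟦ ℤ.sign j ⟧±) * (⟦ ℤ.∣ i ∣ ⟧ℕ * ⟦ ℤ.∣ j ∣ ⟧ℕ) ≈⟨ *-interchange _ _ _ _ ⟩
    (⟦ ℤ.sign i ⟧± * ⟦ ℤ.∣ i ∣ ⟧ℕ) * (⟦ ℤ.sign j ⟧± * ⟦ ℤ.∣ j ∣ ⟧ℕ) ≈⟨ *-cong (⟦⟧-signAbs i) (⟦⟧-signAbs j) ⟨
    ⟦ i ⟧ℤ * ⟦ j ⟧ℤ ∎
    where open import Algebra.Properties.CommutativeSemigroup *-commutativeSemigroup
            renaming (interchange to *-interchange)

  homomorphism : ℤ.+-*-rawRing -Raw-AlmostCommutative⟶ fromCommutativeRing R
  homomorphism = record
    { ⟦_⟧ = ⟦_⟧ℤ ; +-homo = ⟦+⟧ ; *-homo = ⟦*⟧ ; -‿homo = ⟦-⟧ ; 0-homo = refl ; 1-homo = refl }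

  ⟦⟧-≟ : ∀ i j → Maybe (⟦ i ⟧ℤ ≈ ⟦ j ⟧ℤ)
  ⟦⟧-≟ i j with i ℤ.≟ j
  ... | yes ≡.refl = just refl
  ... | no _       = nothing

  open import Algebra.Solver.Ring ℤ.+-*-rawRing (fromCommutativeRing R) homomorphism ⟦⟧-≟ public

  :1 : ∀ {n} → Polynomial n
  :1 = con (+ 1)

double : ℕ → ℕ
double zero    = zero
double (suc k) = suc (suc (double k))

double≡+ : ∀ k → double k ≡ k ℕ.+ k
double≡+ zero    = ≡.refl
double≡+ (suc k) = ≡.cong suc (≡.trans (≡.cong suc (double≡+ k)) (≡.sym (ℕ.+-suc k k)))

⌊double/2⌋ : ∀ k → ⌊ double k /2⌋ ≡ k
⌊double/2⌋ zero    = ≡.refl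
⌊double/2⌋ (suc k) = ≡.cong suc (⌊double/2⌋ k)

⌊1+double/2⌋ : ∀ k → ⌊ suc (double k) /2⌋ ≡ k
⌊1+double/2⌋ zero    = ≡.refl
⌊1+double/2⌋ (suc k) = ≡.cong suc (⌊1+double/2⌋ k)

triangle : ℕ → ℕ
triangle zero    = zero
triangle (suc k) = triangle k ℕ.+ k

triangle-double : ∀ k → triangle k ℕ.+ triangle k ≡ k ℕ.* (k ∸ 1)
triangle-double zero    = ≡.refl
triangle-double (suc k) = begin
  (triangle k ℕ.+ k) ℕ.+ (triangle k ℕ.+ k) ≡⟨ interchange (triangle k) k ⟩
  (triangle k ℕ.+ triangle k) ℕ.+ (k ℕ.+ k) ≡⟨ ≡.cong (ℕ._+ (k ℕ.+ k)) (triangle-double k) ⟩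
  k ℕ.* (k ∸ 1) ℕ.+ (k ℕ.+ k)               ≡⟨ step k ⟩
  suc k ℕ.* k ∎
  where
  open ≡.≡-Reasoning
  interchange : ∀ t k → (t ℕ.+ k) ℕ.+ (t ℕ.+ k) ≡ (t ℕ.+ t) ℕ.+ (k ℕ.+ k)
  interchange = ℕ-solve.solve-∀
  step : ∀ k → k ℕ.* (k ∸ 1) ℕ.+ (k ℕ.+ k) ≡ suc k ℕ.* k
  step zero    = ≡.refl
  step (suc k) = step′ k
    where
    step′ : ∀ k → suc k ℕ.* k ℕ.+ (suc k ℕ.+ suc k) ≡ suc (suc k) ℕ.* suc k
    step′ = ℕ-solve.solve-∀

double≡2* : ∀ k → double k ≡ 2 ℕ.* k
double≡2* k = ≡.trans (double≡+ k) (≡.cong (k ℕ.+_) (≡.sym (ℕ.+-identityʳ k)))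

pos-1+2* : ∀ k → + suc (2 ℕ.* k) ≡ + 1 ℤ.+ + 2 ℤ.* + k
pos-1+2* k = ≡.trans (ℤ.pos-+ 1 (2 ℕ.* k)) (≡.cong (λ i → + 1 ℤ.+ i) (ℤ.pos-* 2 k))

even-exponent : ∀ k m → (+ 1 ℤ.+ + 2 ℤ.* + k) ℤ.* (+ k ℤ.- + (2 ℕ.* k ℕ.+ m)) ≡ ℤ.- + (suc (2 ℕ.* k) ℕ.* (k ℕ.+ m))
even-exponent k m = begin
  (+ 1 ℤ.+ + 2 ℤ.* + k) ℤ.* (+ k ℤ.- + (2 ℕ.* k ℕ.+ m))
    ≡⟨ ≡.cong (λ i → (+ 1 ℤ.+ + 2 ℤ.* + k) ℤ.* (+ k ℤ.- i)) (≡.trans (ℤ.pos-+ (2 ℕ.* k) m) (≡.cong (ℤ._+ + m) (ℤ.pos-* 2 k))) ⟩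
  (+ 1 ℤ.+ + 2 ℤ.* + k) ℤ.* (+ k ℤ.- (+ 2 ℤ.* + k ℤ.+ + m))  ≡⟨ identity (+ k) (+ m) ⟩
  ℤ.- ((+ 1 ℤ.+ + 2 ℤ.* + k) ℤ.* (+ k ℤ.+ + m))
    ≡⟨ ≡.cong ℤ.-_ (≡.trans (ℤ.pos-* (suc (2 ℕ.* k)) (k ℕ.+ m)) (≡.cong₂ ℤ._*_ (pos-1+2* k) (ℤ.pos-+ k m))) ⟨
  ℤ.- + (suc (2 ℕ.* k) ℕ.* (k ℕ.+ m)) ∎
  where
  open ≡.≡-Reasoning
  identity : ∀ K M → (+ 1 ℤ.+ + 2 ℤ.* K) ℤ.* (K ℤ.- (+ 2 ℤ.* K ℤ.+ M)) ≡ ℤ.- ((+ 1 ℤ.+ + 2 ℤ.* K) ℤ.* (K ℤ.+ M))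
  identity = ℤ-solve.solve-∀

odd-exponent : ∀ k m →
  (+ 1 ℤ.+ + k) ℤ.* (+ 1 ℤ.+ + 2 ℤ.* + k ℤ.- + 2 ℤ.* + (2 ℕ.* k ℕ.+ 1 ℕ.+ m)) ≡ ℤ.- + (suc k ℕ.* (suc (2 ℕ.* k) ℕ.+ 2 ℕ.* m))
odd-exponent k m = begin
  (+ 1 ℤ.+ + k) ℤ.* (+ 1 ℤ.+ + 2 ℤ.* + k ℤ.- + 2 ℤ.* + (2 ℕ.* k ℕ.+ 1 ℕ.+ m))
    ≡⟨ ≡.cong (λ i → (+ 1 ℤ.+ + k) ℤ.* (+ 1 ℤ.+ + 2 ℤ.* + k ℤ.- + 2 ℤ.* i)) (ℤ.pos-+ (2 ℕ.* k ℕ.+ 1) m) ⟩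
  (+ 1 ℤ.+ + k) ℤ.* (+ 1 ℤ.+ + 2 ℤ.* + k ℤ.- + 2 ℤ.* (+ (2 ℕ.* k ℕ.+ 1) ℤ.+ + m))
    ≡⟨ ≡.cong (λ i → (+ 1 ℤ.+ + k) ℤ.* (+ 1 ℤ.+ + 2 ℤ.* + k ℤ.- + 2 ℤ.* (i ℤ.+ + m))) (≡.trans (ℤ.pos-+ (2 ℕ.* k) 1) (≡.cong (ℤ._+ + 1) (ℤ.pos-* 2 k))) ⟩
  (+ 1 ℤ.+ + k) ℤ.* (+ 1 ℤ.+ + 2 ℤ.* + k ℤ.- + 2 ℤ.* (+ 2 ℤ.* + k ℤ.+ + 1 ℤ.+ + m))
    ≡⟨ identity (+ k) (+ m) ⟩
  ℤ.- ((+ 1 ℤ.+ + k) ℤ.* (+ 1 ℤ.+ + 2 ℤ.* + k ℤ.+ + 2 ℤ.* + m))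
    ≡⟨ ≡.cong ℤ.-_ (≡.trans (ℤ.pos-* (suc k) (suc (2 ℕ.* k) ℕ.+ 2 ℕ.* m))
                             (≡.cong₂ ℤ._*_ (ℤ.pos-+ 1 k) (≡.trans (ℤ.pos-+ (suc (2 ℕ.* k)) (2 ℕ.* m)) (≡.cong₂ ℤ._+_ (pos-1+2* k) (ℤ.pos-* 2 m))))) ⟨
  ℤ.- + (suc k ℕ.* (suc (2 ℕ.* k) ℕ.+ 2 ℕ.* m)) ∎
  where
  open ≡.≡-Reasoning
  identity : ∀ K M → (+ 1 ℤ.+ K) ℤ.* (+ 1 ℤ.+ + 2 ℤ.* K ℤ.- + 2 ℤ.* (+ 2 ℤ.* K ℤ.+ + 1 ℤ.+ M))
                   ≡ ℤ.- ((+ 1 ℤ.+ K) ℤ.* (+ 1 ℤ.+ + 2 ℤ.* K ℤ.+ + 2 ℤ.* M))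
  identity = ℤ-solve.solve-∀

data Parity : ℕ → Set where
  even : ∀ k → Parity (double k)
  odd  : ∀ k → Parity (suc (double k))

parity : ∀ j → Parity j
parity zero = even zero
parity (suc j) with parity j
... | even k = odd k
... | odd k  = even (suc k)

module QSeries {c ℓ : Level} (F : Field c ℓ) where
  open Field F hiding (zero)
  open FieldOps F
  open IntegerCoefficients commutativeRing
  open import Algebra.Properties.Ring ring using (-1*x≈-x; -0#≈0#; -‿involutive)
  open import Relation.Binary.Reasoning.Setoid setoid

  ≡⇒≈ : ∀ {x y} → x ≡ y → x ≈ y
  ≡⇒≈ ≡.refl = refl

  pow-cong : ∀ {x y} n → x ≈ y → pow x n ≈ pow y n
  pow-cong zero    x≈y = refl
  pow-cong (suc n) x≈y = *-cong x≈y (pow-cong n x≈y)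

  pow-+ : ∀ x m n → pow x (m ℕ.+ n) ≈ pow x m * pow x n
  pow-+ x zero    n = sym (*-identityˡ _)
  pow-+ x (suc m) n = trans (*-congˡ (pow-+ x m n)) (sym (*-assoc x _ _))

  pow-double : ∀ x k → pow x (double k) ≈ pow x k * pow x k
  pow-double x k = trans (≡⇒≈ (≡.cong (pow x) (double≡+ k))) (pow-+ x k k)

  pow-distrib-* : ∀ x y n → pow (x * y) n ≈ pow x n * pow y n
  pow-distrib-* x y zero    = sym (*-identityˡ 1#)
  pow-distrib-* x y (suc n) = begin
    (x * y) * pow (x * y) n        ≈⟨ *-congˡ (pow-distrib-* x y n) ⟩
    (x * y) * (pow x n * pow y n)  ≈⟨ solve 4 (λ x y a b → (x :* y) :* (a :* b) := (x :* a) :* (y :* b)) refl x y (pow x n) (pow y n) ⟩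
    (x * pow x n) * (y * pow y n)  ∎

  pow-1# : ∀ n → pow 1# n ≈ 1#
  pow-1# zero    = refl
  pow-1# (suc n) = trans (*-identityˡ _) (pow-1# n)

  pow-inverse : ∀ {x x′} n → x * x′ ≈ 1# → pow x n * pow x′ n ≈ 1#
  pow-inverse n xx′≈1 = trans (sym (pow-distrib-* _ _ n)) (trans (pow-cong n xx′≈1) (pow-1# n))

  poch-cong : ∀ q {z z′} n → z ≈ z′ → poch q z n ≈ poch q z′ n
  poch-cong q zero    z≈z′ = refl
  poch-cong q (suc n) z≈z′ = *-cong (poch-cong q n z≈z′) (+-congˡ (-‿cong (*-congˡ z≈z′)))

  poch-+ : ∀ q z m n → poch q z (m ℕ.+ n) ≈ poch q z m * poch q (pow q m * z) n
  poch-+ q z m zero = trans (≡⇒≈ (≡.cong (poch q z) (ℕ.+-identityʳ m))) (sym (*-identityʳ _))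
  poch-+ q z m (suc n) = begin
    poch q z (m ℕ.+ suc n)                        ≡⟨ ≡.cong (poch q z) (ℕ.+-suc m n) ⟩
    poch q z (m ℕ.+ n) * (1# - pow q (m ℕ.+ n) * z) ≈⟨ *-cong (poch-+ q z m n) (+-congˡ (-‿cong (*-congʳ (pow-+ q m n)))) ⟩
    (A * B) * (1# - (pow q m * pow q n) * z)        ≈⟨ solve 5 (λ A B x y z → (A :* B) :* (:1 :- (x :* y) :* z) := A :* (B :* (:1 :- y :* (x :* z)))) refl A B (pow q m) (pow q n) z ⟩
    A * (B * (1# - pow q n * (pow q m * z)))        ∎
    where A = poch q z m ; B = poch q (pow q m * z) n

  poch-+₃ : ∀ q z k m l → poch q z (k ℕ.+ (m ℕ.+ l)) ≈ poch q z k * (poch q (pow q k * z) m * poch q (pow q (k ℕ.+ m) * z) l)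
  poch-+₃ q z k m l = trans (poch-+ q z k (m ℕ.+ l)) (*-congˡ (trans (poch-+ q (pow q k * z) m l)
    (*-congˡ (poch-cong q l (trans (sym (*-assoc _ _ _)) (*-congʳ (trans (*-comm _ _) (sym (pow-+ q k m)))))))))

  poch-suc-head : ∀ q z n → poch q z (suc n) ≈ (1# - z) * poch q (q * z) n
  poch-suc-head q z n = trans (poch-+ q z 1 n) (*-cong (trans (*-identityˡ _) (+-congˡ (-‿cong (*-identityˡ z)))) (poch-cong q n (*-congʳ (*-identityʳ q))))

  poch-shift : ∀ q z k m → poch q (pow q k * z) (suc m) ≈ (1# - pow q k * z) * poch q (pow q (suc k) * z) m
  poch-shift q z k m = trans (poch-suc-head q (pow q k * z) m) (*-congˡ (poch-cong q m (sym (*-assoc q (pow q k) z))))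

  sumTo-cong : ∀ n {f g : ℕ → Carrier} → (∀ j → j < n → f j ≈ g j) → sumTo n f ≈ sumTo n g
  sumTo-cong zero    f≈g = refl
  sumTo-cong (suc n) f≈g = +-cong (sumTo-cong n (λ j j<n → f≈g j (ℕ.m≤n⇒m≤1+n j<n))) (f≈g n ℕ.≤-refl)

  sumTo-+ : ∀ n (f g : ℕ → Carrier) → sumTo n (λ j → f j + g j) ≈ sumTo n f + sumTo n g
  sumTo-+ zero    f g = sym (+-identityˡ 0#)
  sumTo-+ (suc n) f g = trans (+-congʳ (sumTo-+ n f g))
    (solve 4 (λ a b c d → (a :+ b) :+ (c :+ d) := (a :+ c) :+ (b :+ d)) refl (sumTo n f) (sumTo n g) (f n) (g n))

  sumTo-sub : ∀ n (f g : ℕ → Carrier) → sumTo n (λ j → f j - g j) ≈ sumTo n f - sumTo n g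
  sumTo-sub zero    f g = solve 0 (con (+ 0) := con (+ 0) :- con (+ 0)) refl
  sumTo-sub (suc n) f g = trans (+-congʳ (sumTo-sub n f g))
    (solve 4 (λ a b c d → (a :- b) :+ (c :- d) := (a :+ c) :- (b :+ d)) refl (sumTo n f) (sumTo n g) (f n) (g n))

  sumTo-*ˡ : ∀ n a (f : ℕ → Carrier) → sumTo n (λ j → a * f j) ≈ a * sumTo n f
  sumTo-*ˡ zero    a f = sym (zeroʳ a)
  sumTo-*ˡ (suc n) a f = trans (+-congʳ (sumTo-*ˡ n a f)) (sym (distribˡ a _ _))

  sumTo-*ʳ : ∀ n a (f : ℕ → Carrier) → sumTo n (λ j → f j * a) ≈ sumTo n f * a
  sumTo-*ʳ zero    a f = sym (zeroˡ a)
  sumTo-*ʳ (suc n) a f = trans (+-congʳ (sumTo-*ʳ n a f)) (sym (distribʳ a _ _))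

  sumTo-suc-head : ∀ n (f : ℕ → Carrier) → sumTo (suc n) f ≈ f 0 + sumTo n (λ j → f (suc j))
  sumTo-suc-head zero    f = trans (+-identityˡ _) (sym (+-identityʳ _))
  sumTo-suc-head (suc n) f = trans (+-congʳ (sumTo-suc-head n f)) (+-assoc _ _ _)

  sumTo-telescope : ∀ n (g : ℕ → Carrier) → sumTo n (λ j → g (suc j) - g j) ≈ g n - g 0
  sumTo-telescope zero    g = sym (-‿inverseʳ (g 0))
  sumTo-telescope (suc n) g = trans (+-congʳ (sumTo-telescope n g))
    (solve 3 (λ a b c → (a :- c) :+ (b :- a) := b :- c) refl (g n) (g (suc n)) (g 0))

  sumTo-vanishing-tail : ∀ n d (f : ℕ → Carrier) → (∀ j → n ≤ j → f j ≈ 0#) → sumTo (n ℕ.+ d) f ≈ sumTo n f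
  sumTo-vanishing-tail n zero    f tail≈0 = ≡⇒≈ (≡.cong (λ m → sumTo m f) (ℕ.+-identityʳ n))
  sumTo-vanishing-tail n (suc d) f tail≈0 = begin
    sumTo (n ℕ.+ suc d) f            ≡⟨ ≡.cong (λ m → sumTo m f) (ℕ.+-suc n d) ⟩
    sumTo (n ℕ.+ d) f + f (n ℕ.+ d)  ≈⟨ +-cong (sumTo-vanishing-tail n d f tail≈0) (tail≈0 (n ℕ.+ d) (ℕ.m≤m+n n d)) ⟩
    sumTo n f + 0#                   ≈⟨ +-identityʳ _ ⟩
    sumTo n f                        ∎

  sumTo-pairs : ∀ n (f : ℕ → Carrier) → sumTo n (λ k → f (2 ℕ.* k) + f (2 ℕ.* k ℕ.+ 1)) ≈ sumTo (2 ℕ.* n) f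
  sumTo-pairs zero    f = refl
  sumTo-pairs (suc n) f = begin
    sumTo n (λ k → f (2 ℕ.* k) + f (2 ℕ.* k ℕ.+ 1)) + (f (2 ℕ.* n) + f (2 ℕ.* n ℕ.+ 1))
      ≈⟨ trans (+-congʳ (sumTo-pairs n f)) (sym (+-assoc _ _ _)) ⟩
    sumTo (2 ℕ.* n) f + f (2 ℕ.* n) + f (2 ℕ.* n ℕ.+ 1)
      ≡⟨ ≡.cong (λ i → sumTo (2 ℕ.* n) f + f (2 ℕ.* n) + f i) (ℕ.+-comm (2 ℕ.* n) 1) ⟩
    sumTo (suc (2 ℕ.* n)) f + f (suc (2 ℕ.* n))
      ≡⟨ ≡.cong (λ m → sumTo m f) (≡.sym (ℕ.*-suc 2 n)) ⟩
    sumTo (2 ℕ.* suc n) f ∎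

  module _ (q : Carrier) where

    gauss-vanishes : ∀ {n j} → n < j → gauss q n j ≈ 0#
    gauss-vanishes {zero}  {suc j} _         = refl
    gauss-vanishes {suc n} {suc j} (s≤s n<j) = begin
      gauss q n j + pow q (suc j) * gauss q n (suc j)
        ≈⟨ +-cong (gauss-vanishes n<j) (*-congˡ (gauss-vanishes (ℕ.m<n⇒m<1+n n<j))) ⟩
      0# + pow q (suc j) * 0#
        ≈⟨ solve 1 (λ p → con (+ 0) :+ p :* con (+ 0) := con (+ 0)) refl (pow q (suc j)) ⟩
      0# ∎

    gauss-ratio : ∀ n j → gauss q n j * (1# - pow q (n ∸ j)) ≈ gauss q n (suc j) * (1# - pow q (suc j))
    gauss-ratio zero    zero    = trans (*-identityˡ _) (trans (-‿inverseʳ 1#) (sym (zeroˡ _)))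
    gauss-ratio zero    (suc j) = trans (zeroˡ _) (sym (zeroˡ _))
    gauss-ratio (suc n) zero    = begin
      1# * (1# - q * pow q n)
        ≈⟨ solve 2 (λ q p → :1 :* (:1 :- q :* p) := (:1 :- q) :+ q :* (:1 :* (:1 :- p))) refl q (pow q n) ⟩
      (1# - q) + q * (1# * (1# - pow q n))
        ≈⟨ +-congˡ (*-congˡ (trans (gauss-ratio n zero) (*-congˡ (+-congˡ (-‿cong (*-identityʳ q)))))) ⟩
      (1# - q) + q * (gauss q n 1 * (1# - q))
        ≈⟨ solve 2 (λ q g → (:1 :- q) :+ q :* (g :* (:1 :- q)) := (:1 :+ q :* :1 :* g) :* (:1 :- q :* :1)) refl q (gauss q n 1) ⟩
      (1# + q * 1# * gauss q n 1) * (1# - q * 1#) ∎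
    gauss-ratio (suc n) (suc j) with suc j ℕ.≤? n
    ... | yes j<n = begin
      (g₀ + Q * A) * (1# - pow q (n ∸ j))
        ≡⟨ ≡.cong (λ i → (g₀ + Q * A) * (1# - pow q i)) (ℕ.+-∸-assoc 1 j<n) ⟩
      (g₀ + Q * A) * (1# - q * T)
        ≈⟨ solve 5 (λ g₀ Q A q T → (g₀ :+ Q :* A) :* (:1 :- q :* T) := g₀ :* (:1 :- q :* T) :+ Q :* A :* (:1 :- q :* T)) refl g₀ Q A q T ⟩
      g₀ * (1# - q * T) + Q * A * (1# - q * T)
        ≈⟨ +-congʳ (trans (≡⇒≈ (≡.cong (λ i → g₀ * (1# - pow q i)) (≡.sym (ℕ.+-∸-assoc 1 j<n)))) (gauss-ratio n j)) ⟩
      A * (1# - Q) + Q * A * (1# - q * T)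
        ≈⟨ solve 4 (λ A Q q T → A :* (:1 :- Q) :+ Q :* A :* (:1 :- q :* T) := A :* (:1 :- q :* Q) :+ q :* Q :* (A :* (:1 :- T))) refl A Q q T ⟩
      A * (1# - q * Q) + q * Q * (A * (1# - T))
        ≈⟨ +-congˡ (*-congˡ (gauss-ratio n (suc j))) ⟩
      A * (1# - q * Q) + q * Q * (C * (1# - q * Q))
        ≈⟨ solve 4 (λ A Q q C → A :* (:1 :- q :* Q) :+ q :* Q :* (C :* (:1 :- q :* Q)) := (A :+ q :* Q :* C) :* (:1 :- q :* Q)) refl A Q q C ⟩
      (A + q * Q * C) * (1# - q * Q) ∎
      where
      g₀ = gauss q n j ; A = gauss q n (suc j) ; C = gauss q n (suc (suc j))
      Q = pow q (suc j) ; T = pow q (n ∸ suc j)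
    ... | no j≮n = begin
      (gauss q n j + pow q (suc j) * gauss q n (suc j)) * (1# - pow q (n ∸ j))
        ≡⟨ ≡.cong (λ i → (gauss q n j + pow q (suc j) * gauss q n (suc j)) * (1# - pow q i)) (ℕ.m≤n⇒m∸n≡0 (ℕ.≤-pred n<1+j)) ⟩
      (gauss q n j + pow q (suc j) * gauss q n (suc j)) * (1# - 1#)
        ≈⟨ trans (*-congˡ (-‿inverseʳ 1#)) (zeroʳ _) ⟩
      0#
        ≈⟨ trans (*-congʳ (gauss-vanishes (s≤s n<1+j))) (zeroˡ _) ⟨
      gauss q (suc n) (suc (suc j)) * (1# - pow q (suc (suc j))) ∎
      where n<1+j = ℕ.≰⇒> j≮n

    sumTo-gauss-pascal : ∀ n (f : ℕ → Carrier) →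
      sumTo (suc (suc n)) (λ j → gauss q (suc n) j * f j) ≈ sumTo (suc n) (λ j → gauss q n j * (f (suc j) + pow q j * f j))
    sumTo-gauss-pascal n f = begin
      sumTo (suc (suc n)) (λ j → gauss q (suc n) j * f j)
        ≈⟨ sumTo-suc-head (suc n) _ ⟩
      1# * f 0 + sumTo (suc n) (λ j → (g j + pow q (suc j) * g (suc j)) * f (suc j))
        ≈⟨ +-congˡ (trans (sumTo-cong (suc n) (λ j _ → distribʳ _ _ _)) (sumTo-+ (suc n) _ _)) ⟩
      1# * f 0 + (sumTo (suc n) (λ j → g j * f (suc j)) + sumTo (suc n) (λ j → pow q (suc j) * g (suc j) * f (suc j)))
        ≈⟨ solve 3 (λ a b c → a :+ (b :+ c) := b :+ (a :+ c)) refl _ _ _ ⟩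
      sumTo (suc n) (λ j → g j * f (suc j)) + (1# * f 0 + sumTo (suc n) (λ j → pow q (suc j) * g (suc j) * f (suc j)))
        ≈⟨ +-congˡ shifted ⟩
      sumTo (suc n) (λ j → g j * f (suc j)) + sumTo (suc n) (λ j → g j * (pow q j * f j))
        ≈⟨ trans (sym (sumTo-+ (suc n) _ _)) (sumTo-cong (suc n) (λ j _ → sym (distribˡ _ _ _))) ⟩
      sumTo (suc n) (λ j → g j * (f (suc j) + pow q j * f j)) ∎
      where
      g = gauss q n
      shifted : 1# * f 0 + sumTo (suc n) (λ j → pow q (suc j) * g (suc j) * f (suc j)) ≈ sumTo (suc n) (λ j → g j * (pow q j * f j))
      shifted = begin
        1# * f 0 + sumTo (suc n) (λ j → pow q (suc j) * g (suc j) * f (suc j))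
          ≈⟨ +-cong (sym (*-identityˡ _)) (sumTo-cong (suc n) (λ j _ → solve 3 (λ a b c → a :* b :* c := b :* (a :* c)) refl _ _ _)) ⟩
        1# * (1# * f 0) + sumTo (suc n) (λ j → g (suc j) * (pow q (suc j) * f (suc j)))
          ≈⟨ sumTo-suc-head (suc n) _ ⟨
        sumTo (suc n) (λ j → g j * (pow q j * f j)) + g (suc n) * (pow q (suc n) * f (suc n))
          ≈⟨ +-congˡ (trans (*-congʳ (gauss-vanishes {n} ℕ.≤-refl)) (zeroˡ _)) ⟩
        sumTo (suc n) (λ j → g j * (pow q j * f j)) + 0#
          ≈⟨ +-identityʳ _ ⟩
        sumTo (suc n) (λ j → g j * (pow q j * f j)) ∎

    sumTo-gauss-telescope : ∀ n (h : ℕ → Carrier) →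
      sumTo (suc n) (λ j → gauss q n j * ((1# - pow q (n ∸ j)) * h (suc j) - (1# - pow q j) * h j)) ≈ 0#
    sumTo-gauss-telescope n h = begin
      sumTo (suc n) (λ j → gauss q n j * ((1# - pow q (n ∸ j)) * h (suc j) - (1# - pow q j) * h j))
        ≈⟨ sumTo-cong (suc n) (λ j _ → difference j) ⟩
      sumTo (suc n) (λ j → t (suc j) - t j)
        ≈⟨ sumTo-telescope (suc n) t ⟩
      gauss q n (suc n) * ((1# - pow q (suc n)) * h (suc n)) - 1# * ((1# - 1#) * h 0)
        ≈⟨ +-cong (trans (*-congʳ (gauss-vanishes {n} ℕ.≤-refl)) (zeroˡ _)) (-‿cong (trans (*-identityˡ _) (trans (*-congʳ (-‿inverseʳ 1#)) (zeroˡ _)))) ⟩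
      0# - 0#
        ≈⟨ -‿inverseʳ 0# ⟩
      0# ∎
      where
      t : ℕ → Carrier
      t j = gauss q n j * ((1# - pow q j) * h j)
      difference : ∀ j → gauss q n j * ((1# - pow q (n ∸ j)) * h (suc j) - (1# - pow q j) * h j) ≈ t (suc j) - t j
      difference j = begin
        gauss q n j * ((1# - pow q (n ∸ j)) * h (suc j) - (1# - pow q j) * h j)
          ≈⟨ solve 5 (λ g a b c d → g :* (a :* b :- c :* d) := g :* a :* b :- g :* (c :* d)) refl _ _ _ _ _ ⟩
        gauss q n j * (1# - pow q (n ∸ j)) * h (suc j) - t j
          ≈⟨ +-congʳ (trans (*-congʳ (gauss-ratio n j)) (*-assoc _ _ _)) ⟩
        t (suc j) - t j ∎

  ρ : Carrier → Carrier → ℕ → Carrier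
  ρ q z zero    = 1#
  ρ q z (suc k) = ρ q z k * (z - pow q (suc k))

  ρ-pow-poch : ∀ q {z z′} → z * z′ ≈ 1# → ∀ k → pow z k * poch q (q * z′) k ≈ ρ q z k
  ρ-pow-poch q zz′≈1 zero = *-identityˡ 1#
  ρ-pow-poch q {z} {z′} zz′≈1 (suc k) = begin
    (z * pow z k) * (poch q (q * z′) k * (1# - pow q k * (q * z′)))
      ≈⟨ solve 6 (λ z pz pc qk q z′ → (z :* pz) :* (pc :* (:1 :- qk :* (q :* z′))) := (pz :* pc) :* (z :- (q :* qk) :* (z :* z′)))
           refl z (pow z k) (poch q (q * z′) k) (pow q k) q z′ ⟩
    (pow z k * poch q (q * z′) k) * (z - (q * pow q k) * (z * z′))
      ≈⟨ *-cong (ρ-pow-poch q zz′≈1 k) (+-congˡ (-‿cong (trans (*-congˡ zz′≈1) (*-identityʳ _)))) ⟩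
    ρ q z k * (z - q * pow q k) ∎

  *-unitʳ : ∀ u {t} → t ≈ 1# → u * t ≈ u
  *-unitʳ u t≈1 = trans (*-congˡ t≈1) (*-identityʳ u)

  ≈0⇒*≈0 : ∀ {u} v → u ≈ 0# → u * v ≈ 0#
  ≈0⇒*≈0 v u≈0 = trans (*-congʳ u≈0) (zeroˡ v)

  flip-factor : ∀ {u u′} → u * u′ ≈ 1# → u * (1# - u′) ≈ - 1# * (1# - u)
  flip-factor {u} {u′} uu′≈1 = begin
    u * (1# - u′)  ≈⟨ solve 2 (λ u u′ → u :* (:1 :- u′) := u :- u :* u′) refl u u′ ⟩
    u - u * u′     ≈⟨ +-congˡ (-‿cong uu′≈1) ⟩
    u - 1#         ≈⟨ solve 1 (λ u → u :- :1 := :- :1 :* (:1 :- u)) refl u ⟩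
    - 1# * (1# - u) ∎

  *-inverse : ∀ {u u′ v v′} → u * u′ ≈ 1# → v * v′ ≈ 1# → (u * v) * (u′ * v′) ≈ 1#
  *-inverse {u} {u′} {v} {v′} uu′≈1 vv′≈1 = begin
    (u * v) * (u′ * v′)  ≈⟨ solve 4 (λ u u′ v v′ → (u :* v) :* (u′ :* v′) := (u :* u′) :* (v :* v′)) refl u u′ v v′ ⟩
    (u * u′) * (v * v′)  ≈⟨ *-cong uu′≈1 vv′≈1 ⟩
    1# * 1#              ≈⟨ *-identityˡ 1# ⟩
    1#                   ∎

  -- The expansion of (wy;q)ₙ (ey;q)ₙ

  module Expansion (q w e y : Carrier) where

    X : Carrier
    X = w * e * y

    coeff : ℕ → Carrier
    coeff j = pow q (⌊ j /2⌋ ℕ.* (⌈ j /2⌉ ∸ 1)) * pow y j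
      * (poch q e ⌈ j /2⌉ * poch q w ⌈ j /2⌉) * (ρ q e ⌊ j /2⌋ * ρ q w ⌊ j /2⌋)

    -- term n j is Fₙ(j), with X in place of x.
    term : ℕ → ℕ → Carrier
    term n j = coeff j * (poch q (pow q ⌊ j /2⌋ * X) (n ∸ j) * poch q (pow q ⌈ j /2⌉ * y) (n ∸ j))

    -- The telescoping remainder of the induction step.  For j = n + 1 the truncated
    -- subtractions make aux n j junk, but there it only occurs multiplied by 1 - q⁰ = 0.
    aux : ℕ → ℕ → Carrier
    aux n j = coeff j
      * (poch q (pow q ⌊ j /2⌋ * X) (n ∸ double ⌊ j /2⌋) * poch q (pow q ⌈ j /2⌉ * y) (suc n ∸ double ⌈ j /2⌉))

    coeff-even : ∀ k → coeff (double k)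
      ≡ pow q (k ℕ.* (k ∸ 1)) * pow y (double k) * (poch q e k * poch q w k) * (ρ q e k * ρ q w k)
    coeff-even k rewrite ⌊double/2⌋ k | ⌊1+double/2⌋ k = ≡.refl

    coeff-odd : ∀ k → coeff (suc (double k))
      ≡ pow q (k ℕ.* k) * pow y (suc (double k)) * (poch q e (suc k) * poch q w (suc k)) * (ρ q e k * ρ q w k)
    coeff-odd k rewrite ⌊double/2⌋ k | ⌊1+double/2⌋ k = ≡.refl

    term-even : ∀ k m → term (double k ℕ.+ m) (double k)
      ≡ coeff (double k) * (poch q (pow q k * X) m * poch q (pow q k * y) m)
    term-even k m rewrite ⌊double/2⌋ k | ⌊1+double/2⌋ k | ℕ.m+n∸m≡n (double k) m = ≡.refl

    term-odd : ∀ k m → term (suc (double k) ℕ.+ m) (suc (double k))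
      ≡ coeff (suc (double k)) * (poch q (pow q k * X) m * poch q (pow q (suc k) * y) m)
    term-odd k m rewrite ⌊double/2⌋ k | ⌊1+double/2⌋ k | ℕ.m+n∸m≡n (double k) m = ≡.refl

    aux-even : ∀ k m → aux (double k ℕ.+ m) (double k)
      ≡ coeff (double k) * (poch q (pow q k * X) m * poch q (pow q k * y) (suc m))
    aux-even k m rewrite ⌊double/2⌋ k | ⌊1+double/2⌋ k | ℕ.+-∸-assoc 1 (ℕ.m≤m+n (double k) m) | ℕ.m+n∸m≡n (double k) m = ≡.refl

    aux-odd : ∀ k m → aux (suc (double k) ℕ.+ m) (suc (double k))
      ≡ coeff (suc (double k)) * (poch q (pow q k * X) (suc m) * poch q (pow q (suc k) * y) m)
    aux-odd k m rewrite ⌊double/2⌋ k | ⌊1+double/2⌋ k | ℕ.+-∸-assoc 1 (ℕ.m≤m+n (double k) m) | ℕ.m+n∸m≡n (double k) m = ≡.refl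

    coeff-even-step : ∀ k → coeff (suc (double k)) ≈ coeff (double k) * (pow q k * y * ((1# - pow q k * e) * (1# - pow q k * w)))
    coeff-even-step k = begin
      coeff (suc (double k))
        ≡⟨ coeff-odd k ⟩
      pow q (k ℕ.* k) * (y * Y) * ((Pe * (1# - Z * e)) * (Pw * (1# - Z * w))) * (Re * Rw)
        ≈⟨ *-congʳ (*-congʳ (*-congʳ (trans (≡⇒≈ (≡.cong (pow q) (k*k≡k*[k∸1]+k k))) (pow-+ q (k ℕ.* (k ∸ 1)) k)))) ⟩
      (P * Z) * (y * Y) * ((Pe * (1# - Z * e)) * (Pw * (1# - Z * w))) * (Re * Rw)
        ≈⟨ solve 10 (λ P Z y Y Pe Pw Re Rw e w →
             (P :* Z) :* (y :* Y) :* ((Pe :* (:1 :- Z :* e)) :* (Pw :* (:1 :- Z :* w))) :* (Re :* Rw)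
             := P :* Y :* (Pe :* Pw) :* (Re :* Rw) :* (Z :* y :* ((:1 :- Z :* e) :* (:1 :- Z :* w))))
             refl P Z y Y Pe Pw Re Rw e w ⟩
      P * Y * (Pe * Pw) * (Re * Rw) * (Z * y * ((1# - Z * e) * (1# - Z * w)))
        ≡⟨ ≡.cong (_* (Z * y * ((1# - Z * e) * (1# - Z * w)))) (coeff-even k) ⟨
      coeff (double k) * (Z * y * ((1# - Z * e) * (1# - Z * w))) ∎
      where
      P = pow q (k ℕ.* (k ∸ 1)) ; Z = pow q k ; Y = pow y (double k)
      Pe = poch q e k ; Pw = poch q w k ; Re = ρ q e k ; Rw = ρ q w k
      k*k≡k*[k∸1]+k : ∀ k → k ℕ.* k ≡ k ℕ.* (k ∸ 1) ℕ.+ k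
      k*k≡k*[k∸1]+k zero    = ≡.refl
      k*k≡k*[k∸1]+k (suc k) = ≡.trans (ℕ.*-suc (suc k) k) (ℕ.+-comm (suc k) _)

    coeff-odd-step : ∀ k → coeff (double (suc k)) ≈ coeff (suc (double k)) * (pow q k * y * ((e - q * pow q k) * (w - q * pow q k)))
    coeff-odd-step k = begin
      coeff (double (suc k))
        ≡⟨ coeff-even (suc k) ⟩
      pow q (k ℕ.+ k ℕ.* k) * (y * (y * Y)) * (Pe * Pw) * ((Re * (e - q * Z)) * (Rw * (w - q * Z)))
        ≈⟨ *-congʳ (*-congʳ (*-congʳ (pow-+ q k (k ℕ.* k)))) ⟩
      (Z * P) * (y * (y * Y)) * (Pe * Pw) * ((Re * (e - q * Z)) * (Rw * (w - q * Z)))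
        ≈⟨ solve 11 (λ P Z y Y Pe Pw Re Rw e w q →
             (Z :* P) :* (y :* (y :* Y)) :* (Pe :* Pw) :* ((Re :* (e :- q :* Z)) :* (Rw :* (w :- q :* Z)))
             := P :* (y :* Y) :* (Pe :* Pw) :* (Re :* Rw) :* (Z :* y :* ((e :- q :* Z) :* (w :- q :* Z))))
             refl P Z y Y Pe Pw Re Rw e w q ⟩
      P * (y * Y) * (Pe * Pw) * (Re * Rw) * (Z * y * ((e - q * Z) * (w - q * Z)))
        ≡⟨ ≡.cong (_* (Z * y * ((e - q * Z) * (w - q * Z)))) (coeff-odd k) ⟨
      coeff (suc (double k)) * (Z * y * ((e - q * Z) * (w - q * Z))) ∎
      where
      P = pow q (k ℕ.* k) ; Z = pow q k ; Y = pow y (double k)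
      Pe = poch q e (suc k) ; Pw = poch q w (suc k) ; Re = ρ q e k ; Rw = ρ q w k

    ratio : ℕ → Carrier
    ratio n = (1# - pow q n * (w * y)) * (1# - pow q n * (e * y))

    TermStep : ℕ → ℕ → Set ℓ
    TermStep n j = term (suc n) (suc j) + pow q j * term (suc n) j
      ≈ ratio n * term n j + ((1# - pow q (n ∸ j)) * aux n (suc j) - (1# - pow q j) * aux n j)

    ratio-cong : ∀ n {Q} → pow q n ≈ Q → ratio n ≈ (1# - Q * (w * y)) * (1# - Q * (e * y))
    ratio-cong n pn≈Q = *-cong (+-congˡ (-‿cong (*-congʳ pn≈Q))) (+-congˡ (-‿cong (*-congʳ pn≈Q)))

    term-step-even-top : ∀ k → TermStep (double k ℕ.+ 0) (double k)
    term-step-even-top k = begin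
      term (suc n) (suc j) + pow q j * term (suc n) j
        ≈⟨ +-cong (trans (≡⇒≈ (term-odd k 0)) (*-congʳ (coeff-even-step k)))
                  (*-cong (pow-double q k) (≡⇒≈ (≡.trans (≡.cong (λ i → term i j) (≡.sym (ℕ.+-suc (double k) 0))) (term-even k 1)))) ⟩
      (c₀ * δ) * (1# * 1#) + (Z * Z) * (c₀ * ((1# * (1# - 1# * (Z * X))) * (1# * (1# - 1# * (Z * y)))))
        ≈⟨ solve 7 (λ c₀ H Z y e w X →
             let δ = Z :* y :* ((:1 :- Z :* e) :* (:1 :- Z :* w))
                 ρ′ = (:1 :- Z :* Z :* (w :* y)) :* (:1 :- Z :* Z :* (e :* y)) in
             (c₀ :* δ) :* (:1 :* :1) :+ (Z :* Z) :* (c₀ :* ((:1 :* (:1 :- :1 :* (Z :* (w :* e :* y)))) :* (:1 :* (:1 :- :1 :* (Z :* y)))))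
             := ρ′ :* (c₀ :* (:1 :* :1)) :+ ((:1 :- :1) :* H :- (:1 :- Z :* Z) :* (c₀ :* (:1 :* (:1 :* (:1 :- :1 :* (Z :* y)))))))
             refl c₀ (aux n (suc j)) Z y e w X ⟩
      (1# - Z * Z * (w * y)) * (1# - Z * Z * (e * y)) * (c₀ * (1# * 1#))
        + ((1# - 1#) * aux n (suc j) - (1# - Z * Z) * (c₀ * (1# * (1# * (1# - 1# * (Z * y))))))
        ≈⟨ +-cong (*-cong (ratio-cong n (trans (≡⇒≈ (≡.cong (pow q) (ℕ.+-identityʳ (double k)))) (pow-double q k))) (≡⇒≈ (term-even k 0)))
                  (+-cong (*-congʳ (+-congˡ (-‿cong (≡⇒≈ (≡.cong (pow q) (ℕ.m+n∸m≡n (double k) 0))))))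
                          (-‿cong (*-cong (+-congˡ (-‿cong (pow-double q k))) (≡⇒≈ (aux-even k 0))))) ⟨
      ratio n * term n j + ((1# - pow q (n ∸ j)) * aux n (suc j) - (1# - pow q j) * aux n j) ∎
      where
      n = double k ℕ.+ 0 ; j = double k
      c₀ = coeff (double k) ; Z = pow q k
      δ = Z * y * ((1# - Z * e) * (1# - Z * w))

    term-step-even : ∀ k m → TermStep (double k ℕ.+ suc m) (double k)
    term-step-even k m = begin
      term (suc n) (suc j) + pow q j * term (suc n) j
        ≈⟨ +-cong (trans (≡⇒≈ (term-odd k (suc m))) (*-congʳ (coeff-even-step k)))
                  (*-cong (pow-double q k) (trans (≡⇒≈ (≡.trans (≡.cong (λ i → term i j) (≡.sym (ℕ.+-suc (double k) (suc m)))) (term-even k (suc (suc m)))))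
                                                   (*-congˡ (*-congˡ (*-congʳ (poch-shift q y k m)))))) ⟩
      (c₀ * δ) * (A * (B * (1# - M * (q * Z * y))))
        + (Z * Z) * (c₀ * ((A * (1# - q * M * (Z * X))) * (((1# - Z * y) * B) * (1# - q * M * (Z * y)))))
        ≈⟨ solve 9 (λ c₀ A B q Z M y e w →
             let δ = Z :* y :* ((:1 :- Z :* e) :* (:1 :- Z :* w)) ; X = w :* e :* y
                 ρ′ = (:1 :- Z :* Z :* (q :* M) :* (w :* y)) :* (:1 :- Z :* Z :* (q :* M) :* (e :* y)) in
             (c₀ :* δ) :* (A :* (B :* (:1 :- M :* (q :* Z :* y))))
               :+ (Z :* Z) :* (c₀ :* ((A :* (:1 :- q :* M :* (Z :* X))) :* (((:1 :- Z :* y) :* B) :* (:1 :- q :* M :* (Z :* y)))))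
             := ρ′ :* (c₀ :* (A :* ((:1 :- Z :* y) :* B)))
               :+ ((:1 :- q :* M) :* ((c₀ :* δ) :* (A :* B)) :- (:1 :- Z :* Z) :* (c₀ :* (A :* (((:1 :- Z :* y) :* B) :* (:1 :- q :* M :* (Z :* y)))))))
             refl c₀ A B q Z M y e w ⟩
      (1# - Z * Z * (q * M) * (w * y)) * (1# - Z * Z * (q * M) * (e * y)) * (c₀ * (A * ((1# - Z * y) * B)))
        + ((1# - q * M) * ((c₀ * δ) * (A * B)) - (1# - Z * Z) * (c₀ * (A * (((1# - Z * y) * B) * (1# - q * M * (Z * y))))))
        ≈⟨ +-cong (*-cong (ratio-cong n (trans (pow-+ q (double k) (suc m)) (*-congʳ (pow-double q k))))
                          (trans (≡⇒≈ (term-even k (suc m))) (*-congˡ (*-congˡ (poch-shift q y k m)))))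
                  (+-cong (*-cong (+-congˡ (-‿cong (≡⇒≈ (≡.cong (pow q) (ℕ.m+n∸m≡n (double k) (suc m))))))
                                  (trans (≡⇒≈ (≡.trans (≡.cong (λ i → aux i (suc j)) (ℕ.+-suc (double k) m)) (aux-odd k m))) (*-congʳ (coeff-even-step k))))
                          (-‿cong (*-cong (+-congˡ (-‿cong (pow-double q k)))
                                          (trans (≡⇒≈ (aux-even k (suc m))) (*-congˡ (*-congˡ (*-congʳ (poch-shift q y k m)))))))) ⟨
      ratio n * term n j + ((1# - pow q (n ∸ j)) * aux n (suc j) - (1# - pow q j) * aux n j) ∎
      where
      n = double k ℕ.+ suc m ; j = double k
      c₀ = coeff (double k) ; Z = pow q k ; M = pow q m
      A = poch q (Z * X) (suc m) ; B = poch q (pow q (suc k) * y) m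
      δ = Z * y * ((1# - Z * e) * (1# - Z * w))

    term-step-odd-top : ∀ k → TermStep (suc (double k) ℕ.+ 0) (suc (double k))
    term-step-odd-top k = begin
      term (suc n) (suc j) + pow q j * term (suc n) j
        ≈⟨ +-cong (trans (≡⇒≈ (term-even (suc k) 0)) (*-congʳ (coeff-odd-step k)))
                  (*-cong (*-congˡ (pow-double q k)) (≡⇒≈ (≡.trans (≡.cong (λ i → term i j) (≡.cong suc (≡.sym (ℕ.+-suc (double k) 0)))) (term-odd k 1)))) ⟩
      (c₁ * δ) * (1# * 1#) + (q * (Z * Z)) * (c₁ * ((1# * (1# - 1# * (Z * X))) * (1# * (1# - 1# * (q * Z * y)))))
        ≈⟨ solve 7 (λ c₁ H q Z y e w →
             let δ = Z :* y :* ((e :- q :* Z) :* (w :- q :* Z))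
                 ρ′ = (:1 :- q :* (Z :* Z) :* (w :* y)) :* (:1 :- q :* (Z :* Z) :* (e :* y)) in
             (c₁ :* δ) :* (:1 :* :1) :+ (q :* (Z :* Z)) :* (c₁ :* ((:1 :* (:1 :- :1 :* (Z :* (w :* e :* y)))) :* (:1 :* (:1 :- :1 :* (q :* Z :* y)))))
             := ρ′ :* (c₁ :* (:1 :* :1)) :+ ((:1 :- :1) :* H :- (:1 :- q :* (Z :* Z)) :* (c₁ :* ((:1 :* (:1 :- :1 :* (Z :* (w :* e :* y)))) :* :1))))
             refl c₁ (aux n (suc j)) q Z y e w ⟩
      (1# - q * (Z * Z) * (w * y)) * (1# - q * (Z * Z) * (e * y)) * (c₁ * (1# * 1#))
        + ((1# - 1#) * aux n (suc j) - (1# - q * (Z * Z)) * (c₁ * ((1# * (1# - 1# * (Z * X))) * 1#)))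
        ≈⟨ +-cong (*-cong (ratio-cong n (*-congˡ (trans (≡⇒≈ (≡.cong (pow q) (ℕ.+-identityʳ (double k)))) (pow-double q k)))) (≡⇒≈ (term-odd k 0)))
                  (+-cong (*-congʳ (+-congˡ (-‿cong (≡⇒≈ (≡.cong (pow q) (ℕ.m+n∸m≡n (suc (double k)) 0))))))
                          (-‿cong (*-cong (+-congˡ (-‿cong (*-congˡ (pow-double q k)))) (≡⇒≈ (aux-odd k 0))))) ⟨
      ratio n * term n j + ((1# - pow q (n ∸ j)) * aux n (suc j) - (1# - pow q j) * aux n j) ∎
      where
      n = suc (double k) ℕ.+ 0 ; j = suc (double k)
      c₁ = coeff (suc (double k)) ; Z = pow q k
      δ = Z * y * ((e - q * Z) * (w - q * Z))

    term-step-odd : ∀ k m → TermStep (suc (double k) ℕ.+ suc m) (suc (double k))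
    term-step-odd k m = begin
      term (suc n) (suc j) + pow q j * term (suc n) j
        ≈⟨ +-cong (trans (≡⇒≈ (term-even (suc k) (suc m))) (*-congʳ (coeff-odd-step k)))
                  (*-cong (*-congˡ (pow-double q k))
                          (trans (≡⇒≈ (≡.trans (≡.cong (λ i → term i j) (≡.cong suc (≡.sym (ℕ.+-suc (double k) (suc m))))) (term-odd k (suc (suc m)))))
                                 (*-congˡ (*-congʳ (*-congʳ (poch-shift q X k m)))))) ⟩
      (c₁ * δ) * ((A * (1# - M * (q * Z * X))) * B)
        + (q * (Z * Z)) * (c₁ * ((((1# - Z * X) * A) * (1# - q * M * (Z * X))) * (B * (1# - q * M * (q * Z * y)))))
        ≈⟨ solve 9 (λ c₁ A B q Z M y e w →
             let δ = Z :* y :* ((e :- q :* Z) :* (w :- q :* Z)) ; X = w :* e :* y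
                 ρ′ = (:1 :- q :* (Z :* Z :* (q :* M)) :* (w :* y)) :* (:1 :- q :* (Z :* Z :* (q :* M)) :* (e :* y)) in
             (c₁ :* δ) :* ((A :* (:1 :- M :* (q :* Z :* X))) :* B)
               :+ (q :* (Z :* Z)) :* (c₁ :* ((((:1 :- Z :* X) :* A) :* (:1 :- q :* M :* (Z :* X))) :* (B :* (:1 :- q :* M :* (q :* Z :* y)))))
             := ρ′ :* (c₁ :* (((:1 :- Z :* X) :* A) :* B))
               :+ ((:1 :- q :* M) :* ((c₁ :* δ) :* (A :* B)) :- (:1 :- q :* (Z :* Z)) :* (c₁ :* ((((:1 :- Z :* X) :* A) :* (:1 :- q :* M :* (Z :* X))) :* B))))
             refl c₁ A B q Z M y e w ⟩
      (1# - q * (Z * Z * (q * M)) * (w * y)) * (1# - q * (Z * Z * (q * M)) * (e * y)) * (c₁ * (((1# - Z * X) * A) * B))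
        + ((1# - q * M) * ((c₁ * δ) * (A * B)) - (1# - q * (Z * Z)) * (c₁ * ((((1# - Z * X) * A) * (1# - q * M * (Z * X))) * B)))
        ≈⟨ +-cong (*-cong (ratio-cong n (*-congˡ (trans (pow-+ q (double k) (suc m)) (*-congʳ (pow-double q k)))))
                          (trans (≡⇒≈ (term-odd k (suc m))) (*-congˡ (*-congʳ (poch-shift q X k m)))))
                  (+-cong (*-cong (+-congˡ (-‿cong (≡⇒≈ (≡.cong (pow q) (ℕ.m+n∸m≡n (suc (double k)) (suc m))))))
                                  (trans (≡⇒≈ (≡.trans (≡.cong (λ i → aux i (suc j)) (≡.cong suc (ℕ.+-suc (double k) m))) (aux-even (suc k) m)))
                                         (*-congʳ (coeff-odd-step k))))
                          (-‿cong (*-cong (+-congˡ (-‿cong (*-congˡ (pow-double q k))))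
                                          (trans (≡⇒≈ (aux-odd k (suc m))) (*-congˡ (*-congʳ (*-congʳ (poch-shift q X k m)))))))) ⟨
      ratio n * term n j + ((1# - pow q (n ∸ j)) * aux n (suc j) - (1# - pow q j) * aux n j) ∎
      where
      n = suc (double k) ℕ.+ suc m ; j = suc (double k)
      c₁ = coeff (suc (double k)) ; Z = pow q k ; M = pow q m
      A = poch q (pow q (suc k) * X) m ; B = poch q (pow q (suc k) * y) (suc m)
      δ = Z * y * ((e - q * Z) * (w - q * Z))

    term-step : ∀ {n j} → j ≤ n → TermStep n j
    term-step {n} {j} j≤n = ≡.subst (λ i → TermStep i j) (ℕ.m+[n∸m]≡n j≤n) (by-parity (n ∸ j) (parity j))
      where
      by-parity : ∀ {j} m → Parity j → TermStep (j ℕ.+ m) j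
      by-parity zero    (even k) = term-step-even-top k
      by-parity (suc m) (even k) = term-step-even k m
      by-parity zero    (odd k)  = term-step-odd-top k
      by-parity (suc m) (odd k)  = term-step-odd k m

    expansion : ∀ n → poch q (w * y) n * poch q (e * y) n ≈ sumTo (suc n) (λ j → gauss q n j * term n j)
    expansion zero = solve 0 (:1 :* :1 := con (+ 0) :+ :1 :* (:1 :* :1 :* (:1 :* :1) :* (:1 :* :1) :* (:1 :* :1))) refl
    expansion (suc n) = begin
      poch q (w * y) (suc n) * poch q (e * y) (suc n)
        ≈⟨ solve 4 (λ a b u v → (a :* (:1 :- u)) :* (b :* (:1 :- v)) := (:1 :- u) :* (:1 :- v) :* (a :* b)) refl _ _ _ _ ⟩
      ratio n * (poch q (w * y) n * poch q (e * y) n)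
        ≈⟨ *-congˡ (expansion n) ⟩
      ratio n * sumTo (suc n) (λ j → g j * term n j)
        ≈⟨ trans (sym (sumTo-*ˡ (suc n) _ _)) (sumTo-cong (suc n) (λ j _ → x∙yz≈y∙xz _ _ _)) ⟩
      sumTo (suc n) (λ j → g j * (ratio n * term n j))
        ≈⟨ +-identityʳ _ ⟨
      sumTo (suc n) (λ j → g j * (ratio n * term n j)) + 0#
        ≈⟨ +-congˡ (sumTo-gauss-telescope q n (aux n)) ⟨
      sumTo (suc n) (λ j → g j * (ratio n * term n j)) + sumTo (suc n) (λ j → g j * D j)
        ≈⟨ trans (sym (sumTo-+ (suc n) _ _)) (sumTo-cong (suc n) (λ j _ → sym (distribˡ _ _ _))) ⟩
      sumTo (suc n) (λ j → g j * (ratio n * term n j + D j))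
        ≈⟨ sumTo-cong (suc n) (λ j j≤n → *-congˡ (sym (term-step (ℕ.≤-pred j≤n)))) ⟩
      sumTo (suc n) (λ j → g j * (term (suc n) (suc j) + pow q j * term (suc n) j))
        ≈⟨ sumTo-gauss-pascal q n (term (suc n)) ⟨
      sumTo (suc (suc n)) (λ j → gauss q (suc n) j * term (suc n) j) ∎
      where
      g = gauss q n
      D : ℕ → Carrier
      D j = (1# - pow q (n ∸ j)) * aux n (suc j) - (1# - pow q j) * aux n j
      open import Algebra.Properties.CommutativeSemigroup *-commutativeSemigroup using (x∙yz≈y∙xz)

  -- Inverses and reversal of q-Pochhammer symbols

  ⁻¹-inverseˡ : ∀ {x} → ¬ x ≈ 0# → x ⁻¹ * x ≈ 1#
  ⁻¹-inverseˡ x≉0 = trans (*-comm _ _) (⁻¹-inverse _ x≉0)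

  ⁻¹-cancelˡ : ∀ {x} y → ¬ x ≈ 0# → x ⁻¹ * (x * y) ≈ y
  ⁻¹-cancelˡ y x≉0 = trans (sym (*-assoc _ _ y)) (trans (*-congʳ (⁻¹-inverseˡ x≉0)) (*-identityˡ y))

  *-cancelˡ : ∀ {x y z} → ¬ x ≈ 0# → x * y ≈ x * z → y ≈ z
  *-cancelˡ {x} {y} {z} x≉0 xy≈xz = trans (sym (⁻¹-cancelˡ y x≉0)) (trans (*-congˡ xy≈xz) (⁻¹-cancelˡ z x≉0))

  *-nonzero : ∀ {x y} → ¬ x ≈ 0# → ¬ y ≈ 0# → ¬ x * y ≈ 0#
  *-nonzero {x} {y} x≉0 y≉0 xy≈0 = y≉0 (trans (sym (⁻¹-cancelˡ y x≉0)) (trans (*-congˡ xy≈0) (zeroʳ _)))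

  ⁻¹-nonzero : ∀ {x} → ¬ x ≈ 0# → ¬ x ⁻¹ ≈ 0#
  ⁻¹-nonzero {x} x≉0 x⁻¹≈0 = 0≉1 (trans (sym (trans (*-congˡ x⁻¹≈0) (zeroʳ x))) (⁻¹-inverse x x≉0))

  pow-nonzero : ∀ {x} n → ¬ x ≈ 0# → ¬ pow x n ≈ 0#
  pow-nonzero zero    x≉0 1≈0 = 0≉1 (sym 1≈0)
  pow-nonzero (suc n) x≉0     = *-nonzero x≉0 (pow-nonzero n x≉0)

  sign : ℕ → Carrier
  sign k = pow (- 1#) k

  sign² : ∀ k → sign k * sign k ≈ 1#
  sign² k = pow-inverse k (solve 0 (:- :1 :* :- :1 := :1) refl)

  module NegativePowers (q : Carrier) (q≉0 : ¬ q ≈ 0#) where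

    q⁻¹ : Carrier
    q⁻¹ = q ⁻¹

    qq⁻¹≈1 : q * q⁻¹ ≈ 1#
    qq⁻¹≈1 = ⁻¹-inverse q q≉0

    pow-q⁻¹ : ∀ n → pow q n * pow q⁻¹ n ≈ 1#
    pow-q⁻¹ n = pow-inverse n qq⁻¹≈1

    pow-q⁻¹ˡ : ∀ n → pow q⁻¹ n * pow q n ≈ 1#
    pow-q⁻¹ˡ n = trans (*-comm _ _) (pow-q⁻¹ n)

    zpow-neg : ∀ n → zpow q (ℤ.- (+ n)) ≈ pow q⁻¹ n
    zpow-neg zero    = refl
    zpow-neg (suc n) = refl

    zpow-1-n : ∀ n → zpow q (+ 1 ℤ.- + n) ≈ q * pow q⁻¹ n
    zpow-1-n zero    = refl
    zpow-1-n (suc n) = begin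
      zpow q (1 ⊖ suc n)          ≡⟨ ≡.cong (zpow q) (ℤ.[1+m]⊖[1+n]≡m⊖n 0 n) ⟩
      zpow q (0 ⊖ n)              ≈⟨ zpow-0⊖ n ⟩
      pow q⁻¹ n                   ≈⟨ *-identityˡ _ ⟨
      1# * pow q⁻¹ n              ≈⟨ *-congʳ qq⁻¹≈1 ⟨
      (q * q⁻¹) * pow q⁻¹ n       ≈⟨ *-assoc q q⁻¹ _ ⟩
      q * pow q⁻¹ (suc n)         ∎
      where
      zpow-0⊖ : ∀ n → zpow q (0 ⊖ n) ≈ pow q⁻¹ n
      zpow-0⊖ zero    = refl
      zpow-0⊖ (suc n) = refl

    exponent-balance : ∀ A B D E → A ℕ.+ E ≡ B ℕ.+ D → pow q⁻¹ A * pow q D ≈ pow q⁻¹ B * pow q E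
    exponent-balance A B D E A+E≡B+D = *-cancelˡ (pow-nonzero (A ℕ.+ E) q≉0) (begin
      pow q (A ℕ.+ E) * (pow q⁻¹ A * pow q D)       ≈⟨ *-congʳ (pow-+ q A E) ⟩
      (pow q A * pow q E) * (pow q⁻¹ A * pow q D)   ≈⟨ solve 4 (λ a e a′ d → (a :* e) :* (a′ :* d) := (a :* a′) :* (d :* e)) refl _ _ _ _ ⟩
      (pow q A * pow q⁻¹ A) * (pow q D * pow q E)   ≈⟨ *-congʳ (trans (pow-q⁻¹ A) (sym (pow-q⁻¹ B))) ⟩
      (pow q B * pow q⁻¹ B) * (pow q D * pow q E)   ≈⟨ solve 4 (λ b b′ d e → (b :* b′) :* (d :* e) := (b :* d) :* (b′ :* e)) refl _ _ _ _ ⟩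
      (pow q B * pow q D) * (pow q⁻¹ B * pow q E)   ≈⟨ *-congʳ (trans (≡⇒≈ (≡.cong (pow q) A+E≡B+D)) (pow-+ q B D)) ⟨
      pow q (A ℕ.+ E) * (pow q⁻¹ B * pow q E)       ∎)

    factor-reverse : ∀ {z z′} → z * z′ ≈ 1# → ∀ K t →
      z * (1# - pow q K * (pow q⁻¹ (suc (K ℕ.+ t)) * (q * z′))) ≈ - 1# * pow q⁻¹ t * (1# - pow q t * z)
    factor-reverse {z} {z′} zz′≈1 K t = begin
      z * (1# - pow q K * (q⁻¹ * pow q⁻¹ (K ℕ.+ t) * (q * z′)))
        ≈⟨ *-congˡ (+-congˡ (-‿cong (*-congˡ (*-congʳ (*-congˡ (pow-+ q⁻¹ K t)))))) ⟩
      z * (1# - Qᴷ * (q⁻¹ * (Iᴷ * Iᵗ) * (q * z′)))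
        ≈⟨ solve 7 (λ z z′ Qᴷ q⁻¹ Iᴷ Iᵗ q → z :* (:1 :- Qᴷ :* (q⁻¹ :* (Iᴷ :* Iᵗ) :* (q :* z′))) := z :- (Qᴷ :* Iᴷ) :* (q :* q⁻¹) :* (z :* z′) :* Iᵗ)
             refl z z′ Qᴷ q⁻¹ Iᴷ Iᵗ q ⟩
      z - (Qᴷ * Iᴷ) * (q * q⁻¹) * (z * z′) * Iᵗ
        ≈⟨ +-congˡ (-‿cong (*-congʳ (*-cong (*-cong (pow-q⁻¹ K) qq⁻¹≈1) zz′≈1))) ⟩
      z - 1# * 1# * 1# * Iᵗ
        ≈⟨ solve 3 (λ z Iᵗ Qᵗ → z :- :1 :* :1 :* :1 :* Iᵗ := :- :1 :* Iᵗ :* (:1 :- Qᵗ :* z) :+ (z :- (Iᵗ :* Qᵗ) :* z)) refl z Iᵗ Qᵗ ⟩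
      - 1# * Iᵗ * (1# - Qᵗ * z) + (z - (Iᵗ * Qᵗ) * z)
        ≈⟨ +-congˡ (+-congˡ (-‿cong (*-congʳ (pow-q⁻¹ˡ t)))) ⟩
      - 1# * Iᵗ * (1# - Qᵗ * z) + (z - 1# * z)
        ≈⟨ trans (+-congˡ (solve 1 (λ z → z :- :1 :* z := con (+ 0)) refl z)) (+-identityʳ _) ⟩
      - 1# * Iᵗ * (1# - Qᵗ * z) ∎
      where Qᴷ = pow q K ; Iᴷ = pow q⁻¹ K ; Iᵗ = pow q⁻¹ t ; Qᵗ = pow q t

    poch-reverse : ∀ {z z′} → z * z′ ≈ 1# → ∀ K t →
      pow z K * poch q (pow q⁻¹ (K ℕ.+ t) * (q * z′)) K ≈ sign K * pow q⁻¹ (triangle K ℕ.+ K ℕ.* t) * poch q (pow q t * z) K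
    poch-reverse zz′≈1 zero t = solve 0 (:1 :* :1 := :1 :* :1 :* :1) refl
    poch-reverse {z} {z′} zz′≈1 (suc K) t = begin
      (z * pow z K) * (poch q u K * (1# - pow q K * u))
        ≈⟨ solve 4 (λ z pz a b → (z :* pz) :* (a :* b) := (pz :* a) :* (z :* b)) refl z (pow z K) (poch q u K) (1# - pow q K * u) ⟩
      (pow z K * poch q u K) * (z * (1# - pow q K * u))
        ≈⟨ *-cong (trans (*-congˡ (poch-cong q K (*-congʳ (≡⇒≈ (≡.cong (pow q⁻¹) (≡.sym (ℕ.+-suc K t)))))))
                         (poch-reverse zz′≈1 K (suc t)))
                  (factor-reverse zz′≈1 K t) ⟩
      (sign K * pow q⁻¹ (triangle K ℕ.+ K ℕ.* suc t) * poch q (pow q (suc t) * z) K) * (- 1# * Iᵗ * (1# - pow q t * z))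
        ≈⟨ *-congʳ (*-cong (*-congˡ (≡⇒≈ (≡.cong (pow q⁻¹) exponent))) (poch-cong q K (*-assoc q (pow q t) z))) ⟩
      (sign K * pow q⁻¹ (triangle K ℕ.+ K ℕ.+ K ℕ.* t) * poch q (q * (pow q t * z)) K) * (- 1# * Iᵗ * (1# - pow q t * z))
        ≈⟨ solve 6 (λ s A B m I c → (s :* A :* B) :* (m :* I :* c) := (m :* s) :* (A :* I) :* (c :* B)) refl _ _ _ _ _ _ ⟩
      (- 1# * sign K) * (pow q⁻¹ (triangle K ℕ.+ K ℕ.+ K ℕ.* t) * Iᵗ) * ((1# - pow q t * z) * poch q (q * (pow q t * z)) K)
        ≈⟨ *-cong (*-congˡ (trans (sym (pow-+ q⁻¹ (triangle K ℕ.+ K ℕ.+ K ℕ.* t) t)) (≡⇒≈ (≡.cong (pow q⁻¹) exponent′)))) (sym (poch-suc-head q (pow q t * z) K)) ⟩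
      sign (suc K) * pow q⁻¹ (triangle (suc K) ℕ.+ suc K ℕ.* t) * poch q (pow q t * z) (suc K) ∎
      where
      u = pow q⁻¹ (suc K ℕ.+ t) * (q * z′) ; Iᵗ = pow q⁻¹ t
      exponent : triangle K ℕ.+ K ℕ.* suc t ≡ triangle K ℕ.+ K ℕ.+ K ℕ.* t
      exponent = ≡.trans (≡.cong (triangle K ℕ.+_) (ℕ.*-suc K t)) (≡.sym (ℕ.+-assoc (triangle K) K (K ℕ.* t)))
      exponent′ : triangle K ℕ.+ K ℕ.+ K ℕ.* t ℕ.+ t ≡ triangle (suc K) ℕ.+ suc K ℕ.* t
      exponent′ = ≡.trans (ℕ.+-assoc (triangle K ℕ.+ K) (K ℕ.* t) t) (≡.cong (triangle K ℕ.+ K ℕ.+_) (ℕ.+-comm (K ℕ.* t) t))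

  -- Matching the expansion with the two sums

  fraction-product : ∀ g N m₁ m₂ F {d₁ d₂ d₃ D} → ¬ d₁ ≈ 0# → ¬ d₂ ≈ 0# → ¬ d₃ ≈ 0# → ¬ D ≈ 0# →
    N * m₁ * m₂ * D ≈ F * (d₁ * d₂ * d₃) → g * (N / d₁) * (m₁ / d₂) * (m₂ / d₃) ≈ g * F / D
  fraction-product g N m₁ m₂ F {d₁} {d₂} {d₃} {D} d₁≉0 d₂≉0 d₃≉0 D≉0 cross = begin
    g * (N * d₁ ⁻¹) * (m₁ * d₂ ⁻¹) * (m₂ * d₃ ⁻¹)
      ≈⟨ solve 7 (λ g N m₁ m₂ i₁ i₂ i₃ → g :* (N :* i₁) :* (m₁ :* i₂) :* (m₂ :* i₃) := g :* (N :* m₁ :* m₂) :* (i₁ :* i₂ :* i₃) :* :1) refl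
           g N m₁ m₂ (d₁ ⁻¹) (d₂ ⁻¹) (d₃ ⁻¹) ⟩
    g * (N * m₁ * m₂) * (d₁ ⁻¹ * d₂ ⁻¹ * d₃ ⁻¹) * 1#
      ≈⟨ *-congˡ (⁻¹-inverse D D≉0) ⟨
    g * (N * m₁ * m₂) * (d₁ ⁻¹ * d₂ ⁻¹ * d₃ ⁻¹) * (D * D ⁻¹)
      ≈⟨ solve 9 (λ g N m₁ m₂ i₁ i₂ i₃ D j → g :* (N :* m₁ :* m₂) :* (i₁ :* i₂ :* i₃) :* (D :* j) := g :* (N :* m₁ :* m₂ :* D) :* (j :* i₁ :* i₂ :* i₃)) refl
           g N m₁ m₂ (d₁ ⁻¹) (d₂ ⁻¹) (d₃ ⁻¹) D (D ⁻¹) ⟩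
    g * (N * m₁ * m₂ * D) * (D ⁻¹ * d₁ ⁻¹ * d₂ ⁻¹ * d₃ ⁻¹)
      ≈⟨ *-congʳ (*-congˡ cross) ⟩
    g * (F * (d₁ * d₂ * d₃)) * (D ⁻¹ * d₁ ⁻¹ * d₂ ⁻¹ * d₃ ⁻¹)
      ≈⟨ solve 9 (λ g F d₁ d₂ d₃ j i₁ i₂ i₃ → g :* (F :* (d₁ :* d₂ :* d₃)) :* (j :* i₁ :* i₂ :* i₃) := g :* F :* j :* ((d₁ :* i₁) :* (d₂ :* i₂) :* (d₃ :* i₃))) refl
           g F d₁ d₂ d₃ (D ⁻¹) (d₁ ⁻¹) (d₂ ⁻¹) (d₃ ⁻¹) ⟩
    g * F * D ⁻¹ * ((d₁ * d₁ ⁻¹) * (d₂ * d₂ ⁻¹) * (d₃ * d₃ ⁻¹))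
      ≈⟨ *-congˡ (*-cong (*-cong (⁻¹-inverse d₁ d₁≉0) (⁻¹-inverse d₂ d₂≉0)) (⁻¹-inverse d₃ d₃≉0)) ⟩
    g * F * D ⁻¹ * (1# * 1# * 1#)
      ≈⟨ solve 3 (λ g F j → g :* F :* j :* (:1 :* :1 :* :1) := g :* F :* j) refl g F (D ⁻¹) ⟩
    g * F * D ⁻¹ ∎

  module Matching (q a c e : Carrier) (q≉0 : ¬ q ≈ 0#) (a≉0 : ¬ a ≈ 0#) (c≉0 : ¬ c ≈ 0#) (e≉0 : ¬ e ≈ 0#) where
    open NegativePowers q q≉0

    x y w x′ y′ w′ : Carrier
    x = a * e
    y = c / e
    w = a * e / c
    x′ = (a * e) ⁻¹
    y′ = e / c
    w′ = c / (a * e)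

    open Expansion q w e y

    x≉0 : ¬ x ≈ 0#
    x≉0 = *-nonzero a≉0 e≉0

    y≉0 : ¬ y ≈ 0#
    y≉0 = *-nonzero c≉0 (⁻¹-nonzero e≉0)

    w≉0 : ¬ w ≈ 0#
    w≉0 = *-nonzero x≉0 (⁻¹-nonzero c≉0)

    xx′≈1 : x * x′ ≈ 1#
    xx′≈1 = ⁻¹-inverse x x≉0

    ee′≈1 : e * e ⁻¹ ≈ 1#
    ee′≈1 = ⁻¹-inverse e e≉0

    cc′≈1 : c * c ⁻¹ ≈ 1#
    cc′≈1 = ⁻¹-inverse c c≉0

    cc′ee′≈1 : (c * c ⁻¹) * (e * e ⁻¹) ≈ 1#
    cc′ee′≈1 = trans (*-cong cc′≈1 ee′≈1) (*-identityˡ 1#)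

    yy′≈1 : y * y′ ≈ 1#
    yy′≈1 = trans (*-congˡ (*-comm e (c ⁻¹))) (*-inverse cc′≈1 (⁻¹-inverseˡ e≉0))

    ww′≈1 : w * w′ ≈ 1#
    ww′≈1 = trans (*-congˡ (*-comm c x′)) (*-inverse xx′≈1 (⁻¹-inverseˡ c≉0))

    X≈x : X ≈ x
    X≈x = trans (solve 5 (λ a e c c′ e′ → a :* e :* c′ :* e :* (c :* e′) := (a :* e) :* ((c :* c′) :* (e :* e′))) refl a e c (c ⁻¹) (e ⁻¹))
                (*-unitʳ x cc′ee′≈1)

    wy≈a : w * y ≈ a
    wy≈a = trans (solve 5 (λ a e c c′ e′ → a :* e :* c′ :* (c :* e′) := a :* ((c :* c′) :* (e :* e′))) refl a e c (c ⁻¹) (e ⁻¹))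
                 (*-unitʳ a cc′ee′≈1)

    ey≈c : e * y ≈ c
    ey≈c = trans (solve 3 (λ e c e′ → e :* (c :* e′) := c :* (e :* e′)) refl e c (e ⁻¹)) (*-unitʳ c ee′≈1)

    module Even (k m : ℕ) where
      n α β γ κ : ℕ
      Z U Px₁ Px₂ Px₃ Py₁ Py₂ Py₂′ Py₃ Pe Pw Pe′ Pw′ Re Rw z₁ z₂ N : Carrier
      n = 2 ℕ.* k ℕ.+ m
      Z = pow q k
      U = pow q (k ℕ.+ m)
      α = suc (2 ℕ.* k) ℕ.* (k ℕ.+ m)
      β = triangle k ℕ.+ k ℕ.* (k ℕ.+ m)
      γ = triangle k ℕ.+ k ℕ.* suc (k ℕ.+ m)
      κ = k ℕ.* (k ∸ 1)
      Px₁ = poch q x k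
      Px₂ = poch q (Z * x) m
      Px₃ = poch q (U * x) k
      Py₁ = poch q (q * y) k
      Py₂ = poch q (Z * (q * y)) m
      Py₂′ = poch q (Z * y) m
      Py₃ = poch q (pow q (suc (k ℕ.+ m)) * y) k
      Pe = poch q e k
      Pw = poch q w k
      Pe′ = poch q (q / e) k
      Pw′ = poch q (q * c / (a * e)) k
      Re = ρ q e k
      Rw = ρ q w k
      z₁ = zpow q (+ 1 ℤ.- + n) / (a * e)
      z₂ = zpow q (ℤ.- (+ n)) * e / c

      n≡k+[m+k] : 2 ℕ.* k ℕ.+ m ≡ k ℕ.+ (m ℕ.+ k)
      n≡k+[m+k] = ℕ-solve.solve (k ∷ m ∷ [])
      n≡k+[k+m] : 2 ℕ.* k ℕ.+ m ≡ k ℕ.+ (k ℕ.+ m)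
      n≡k+[k+m] = ℕ-solve.solve (k ∷ m ∷ [])
      n≡[k+m]+k : 2 ℕ.* k ℕ.+ m ≡ k ℕ.+ m ℕ.+ k
      n≡[k+m]+k = ℕ-solve.solve (k ∷ m ∷ [])

      N = (1# - zpow q (ℤ.- (+ k)) * e / c) * zpow q ((+ 1 ℤ.+ + 2 ℤ.* + k) ℤ.* (+ k ℤ.- + n))

      numerator : N ≈ (1# - pow q⁻¹ k * y′) * pow q⁻¹ α
      numerator = *-cong (+-congˡ (-‿cong (trans (*-congʳ (*-congʳ (zpow-neg k))) (*-assoc _ _ _))))
                         (trans (≡⇒≈ (≡.cong (zpow q) (even-exponent k m))) (zpow-neg α))

      split-x : poch q x n ≈ Px₁ * (Px₂ * Px₃)
      split-x = trans (≡⇒≈ (≡.cong (poch q x) n≡k+[m+k])) (poch-+₃ q x k m k)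

      split-y : poch q (q * c / e) n ≈ Py₁ * (Py₂ * Py₃)
      split-y = trans (poch-cong q n (*-assoc q c (e ⁻¹))) (trans (≡⇒≈ (≡.cong (poch q (q * y)) n≡k+[m+k]))
        (trans (poch-+₃ q (q * y) k m k) (*-congˡ (*-congˡ (poch-cong q k
          (solve 3 (λ p q y → p :* (q :* y) := q :* p :* y) refl (pow q (k ℕ.+ m)) q y))))))

      reverse-x : pow x k * poch q z₁ k ≈ sign k * pow q⁻¹ β * Px₃
      reverse-x = trans (*-congˡ (poch-cong q k z₁≈)) (poch-reverse xx′≈1 k (k ℕ.+ m))
        where
        z₁≈ : z₁ ≈ pow q⁻¹ (k ℕ.+ (k ℕ.+ m)) * (q * x′)
        z₁≈ = trans (*-congʳ (zpow-1-n n)) (trans (solve 3 (λ q p x′ → q :* p :* x′ := p :* (q :* x′)) refl q (pow q⁻¹ n) x′)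
                    (*-congʳ (≡⇒≈ (≡.cong (pow q⁻¹) n≡k+[k+m]))))

      z₂≈ : z₂ ≈ pow q⁻¹ n * y′
      z₂≈ = trans (*-congʳ (*-congʳ (zpow-neg n))) (*-assoc _ _ _)

      reverse-y : pow y k * poch q z₂ k ≈ sign k * pow q⁻¹ γ * Py₃
      reverse-y = trans (*-congˡ (poch-cong q k z₂≈′)) (poch-reverse yy′≈1 k (suc (k ℕ.+ m)))
        where
        z₂≈′ : z₂ ≈ pow q⁻¹ (k ℕ.+ suc (k ℕ.+ m)) * (q * y′)
        z₂≈′ = begin
          z₂                                   ≈⟨ z₂≈ ⟩
          pow q⁻¹ n * y′                       ≈⟨ *-unitʳ _ (⁻¹-inverseˡ q≉0) ⟨
          pow q⁻¹ n * y′ * (q⁻¹ * q)           ≈⟨ solve 4 (λ p y′ i q → p :* y′ :* (i :* q) := i :* p :* (q :* y′)) refl (pow q⁻¹ n) y′ q⁻¹ q ⟩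
          pow q⁻¹ (suc n) * (q * y′)           ≡⟨ ≡.cong (λ i → pow q⁻¹ i * (q * y′)) (≡.trans (≡.cong suc n≡k+[k+m]) (≡.sym (ℕ.+-suc k (k ℕ.+ m)))) ⟩
          pow q⁻¹ (k ℕ.+ suc (k ℕ.+ m)) * (q * y′) ∎

      first-factor : (Z * y) * (1# - pow q⁻¹ k * y′) ≈ - 1# * (1# - Z * y)
      first-factor = flip-factor (*-inverse (pow-q⁻¹ k) yy′≈1)

      last-factor : (U * y) * (1# - Z * z₂) ≈ - 1# * (1# - U * y)
      last-factor = flip-factor (begin
        (U * y) * (Z * z₂)                 ≈⟨ *-congˡ (*-congˡ z₂≈) ⟩
        (U * y) * (Z * (pow q⁻¹ n * y′))   ≈⟨ solve 5 (λ U y Z p y′ → (U :* y) :* (Z :* (p :* y′)) := (U :* Z :* y) :* (p :* y′)) refl U y Z (pow q⁻¹ n) y′ ⟩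
        (U * Z * y) * (pow q⁻¹ n * y′)     ≈⟨ *-inverse (trans (*-congʳ UZ≈qⁿ) (pow-q⁻¹ n)) yy′≈1 ⟩
        1#                                 ∎)
        where
        UZ≈qⁿ : U * Z ≈ pow q n
        UZ≈qⁿ = trans (sym (pow-+ q (k ℕ.+ m) k)) (≡⇒≈ (≡.cong (pow q) (≡.sym n≡[k+m]+k)))

      shift-y : (1# - Z * y) * Py₂ ≈ Py₂′ * (1# - U * y)
      shift-y = begin
        (1# - Z * y) * Py₂                      ≈⟨ *-congˡ (poch-cong q m (solve 3 (λ Z q y → Z :* (q :* y) := q :* (Z :* y)) refl Z q y)) ⟩
        (1# - Z * y) * poch q (q * (Z * y)) m   ≈⟨ poch-suc-head q (Z * y) m ⟨
        Py₂′ * (1# - pow q m * (Z * y))         ≈⟨ *-congˡ (+-congˡ (-‿cong (trans (solve 3 (λ M Z y → M :* (Z :* y) := Z :* M :* y) refl (pow q m) Z y)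
                                                                              (*-congʳ (sym (pow-+ q k m)))))) ⟩
        Py₂′ * (1# - U * y)                     ∎

      term-form : term n (2 ℕ.* k) ≈ (pow q κ * pow y (double k) * (Pe * Pw) * (Re * Rw)) * (Px₂ * Py₂′)
      term-form = begin
        term n (2 ℕ.* k)                 ≡⟨ ≡.cong₂ term (≡.cong (ℕ._+ m) (≡.sym (double≡2* k))) (≡.sym (double≡2* k)) ⟩
        term (double k ℕ.+ m) (double k) ≡⟨ ≡.trans (term-even k m) (≡.cong (_* (poch q (Z * X) m * Py₂′)) (coeff-even k)) ⟩
        (pow q κ * pow y (double k) * (Pe * Pw) * (Re * Rw)) * (poch q (Z * X) m * Py₂′)
                                         ≈⟨ *-congˡ (*-congʳ (poch-cong q m (*-congˡ X≈x))) ⟩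
        (pow q κ * pow y (double k) * (Pe * Pw) * (Re * Rw)) * (Px₂ * Py₂′) ∎

      Y xᵏ yᵏ eᵏ wᵏ Iα Iβ Iγ Qκ s P₁ P₂ L L′ Mono : Carrier
      Y = pow y (double k)
      xᵏ = pow x k ; yᵏ = pow y k ; eᵏ = pow e k ; wᵏ = pow w k
      Iα = pow q⁻¹ α ; Iβ = pow q⁻¹ β ; Iγ = pow q⁻¹ γ ; Qκ = pow q κ ; s = sign k
      P₁ = poch q z₁ k ; P₂ = poch q z₂ k
      L = 1# - pow q⁻¹ k * y′ ; L′ = 1# - Z * z₂

      Mono = Qκ * Y * (s * s) * Iβ * Iγ * eᵏ * wᵏ * Z

      monomials : Iα * U * xᵏ * yᵏ ≈ Mono
      monomials = begin
        Iα * U * xᵏ * yᵏ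
          ≈⟨ *-congʳ (*-congˡ (trans (pow-cong k (sym X≈x)) (trans (pow-distrib-* (w * e) y k) (*-congʳ (pow-distrib-* w e k))))) ⟩
        pow q⁻¹ α * U * (pow w k * pow e k * pow y k) * pow y k
          ≈⟨ solve 6 (λ a u w e y y′ → a :* u :* (w :* e :* y) :* y′ := (a :* u) :* (w :* e :* y :* y′)) refl (pow q⁻¹ α) U (pow w k) (pow e k) (pow y k) (pow y k) ⟩
        (pow q⁻¹ α * U) * (pow w k * pow e k * pow y k * pow y k)
          ≈⟨ *-congʳ (exponent-balance α (β ℕ.+ γ) (k ℕ.+ m) (κ ℕ.+ k) balance) ⟩
        (pow q⁻¹ (β ℕ.+ γ) * pow q (κ ℕ.+ k)) * (pow w k * pow e k * pow y k * pow y k)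
          ≈⟨ *-congʳ (*-cong (pow-+ q⁻¹ β γ) (pow-+ q κ k)) ⟩
        ((pow q⁻¹ β * pow q⁻¹ γ) * (pow q κ * Z)) * (pow w k * pow e k * pow y k * pow y k)
          ≈⟨ solve 8 (λ b c p z w e y y′ → ((b :* c) :* (p :* z)) :* (w :* e :* y :* y′) := p :* (y :* y′) :* :1 :* b :* c :* e :* w :* z) refl
               (pow q⁻¹ β) (pow q⁻¹ γ) (pow q κ) Z (pow w k) (pow e k) (pow y k) (pow y k) ⟩
        pow q κ * (pow y k * pow y k) * 1# * pow q⁻¹ β * pow q⁻¹ γ * pow e k * pow w k * Z
          ≈⟨ *-congʳ (*-congʳ (*-congʳ (*-congʳ (*-congʳ (*-cong (*-congˡ (pow-double y k)) (sign² k)))))) ⟨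
        Mono ∎
        where
        balance : α ℕ.+ (κ ℕ.+ k) ≡ (β ℕ.+ γ) ℕ.+ (k ℕ.+ m)
        balance = ≡.trans (≡.cong (λ t → α ℕ.+ (t ℕ.+ k)) (≡.sym (triangle-double k))) (identity k m (triangle k))
          where
          identity : ∀ k m t → suc (2 ℕ.* k) ℕ.* (k ℕ.+ m) ℕ.+ ((t ℕ.+ t) ℕ.+ k)
                             ≡ (t ℕ.+ k ℕ.* (k ℕ.+ m) ℕ.+ (t ℕ.+ k ℕ.* suc (k ℕ.+ m))) ℕ.+ (k ℕ.+ m)
          identity = ℕ-solve.solve-∀

      -- V supplies the factors xᵏ, yᵏ, eᵏ, wᵏ, qᵏy and q^{k+m}y consumed by the reversal and ρ
      -- lemmas; multiplied by V, both sides of cross-multiplied become - Mono * Common.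
      V Common : Carrier
      V = xᵏ * yᵏ * eᵏ * wᵏ * (Z * y) * (U * y)
      Common = Py₂′ * (1# - U * y) * Re * Rw * Pe * Pw * Px₁ * Px₂ * Px₃ * Py₁ * Py₃ * y

      ρ-w : wᵏ * Pw′ ≈ Rw
      ρ-w = trans (*-congˡ (poch-cong q k (*-assoc q c x′))) (ρ-pow-poch q ww′≈1 k)

      Py₁≈ : poch q (q * c / e) k ≈ Py₁
      Py₁≈ = poch-cong q k (*-assoc q c (e ⁻¹))

      scaled-statement : V * (N * (Pe * Pw) * (Pe′ * Pw′) * (poch q x n * poch q (q * c / e) n)) ≈ - 1# * (Mono * Common)
      scaled-statement = begin
        V * (N * (Pe * Pw) * (Pe′ * Pw′) * (poch q x n * poch q (q * c / e) n))
          ≈⟨ *-congˡ (*-cong (*-congʳ (*-congʳ numerator)) (*-cong split-x split-y)) ⟩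
        V * ((L * Iα) * (Pe * Pw) * (Pe′ * Pw′) * ((Px₁ * (Px₂ * Px₃)) * (Py₁ * (Py₂ * Py₃))))
          ≈⟨ solve 19 (λ xᵏ yᵏ eᵏ wᵏ Z y U L Iα Pe Pw Pe′ Pw′ Px₁ Px₂ Px₃ Py₁ Py₂ Py₃ →
               (xᵏ :* yᵏ :* eᵏ :* wᵏ :* (Z :* y) :* (U :* y)) :* ((L :* Iα) :* (Pe :* Pw) :* (Pe′ :* Pw′) :* ((Px₁ :* (Px₂ :* Px₃)) :* (Py₁ :* (Py₂ :* Py₃))))
               := ((Z :* y) :* L) :* Py₂ :* (eᵏ :* Pe′) :* (wᵏ :* Pw′) :* (Iα :* U :* xᵏ :* yᵏ :* y :* Pe :* Pw :* Px₁ :* Px₂ :* Px₃ :* Py₁ :* Py₃))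
               refl xᵏ yᵏ eᵏ wᵏ Z y U L Iα Pe Pw Pe′ Pw′ Px₁ Px₂ Px₃ Py₁ Py₂ Py₃ ⟩
        ((Z * y) * L) * Py₂ * (eᵏ * Pe′) * (wᵏ * Pw′) * Rest
          ≈⟨ *-congʳ (*-cong (*-cong (*-congʳ first-factor) (ρ-pow-poch q ee′≈1 k)) ρ-w) ⟩
        (- 1# * (1# - Z * y)) * Py₂ * Re * Rw * Rest
          ≈⟨ solve 5 (λ A B C D E → (:- :1 :* A) :* B :* C :* D :* E := :- :1 :* ((A :* B) :* C :* D :* E)) refl (1# - Z * y) Py₂ Re Rw Rest ⟩
        - 1# * (((1# - Z * y) * Py₂) * Re * Rw * Rest)
          ≈⟨ *-congˡ (*-congʳ (*-congʳ (*-congʳ shift-y))) ⟩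
        - 1# * ((Py₂′ * (1# - U * y)) * Re * Rw * Rest)
          ≈⟨ *-congˡ (solve 16 (λ Py₂′ L′ Re Rw Iα U xᵏ yᵏ y Pe Pw Px₁ Px₂ Px₃ Py₁ Py₃ →
               (Py₂′ :* L′) :* Re :* Rw :* (Iα :* U :* xᵏ :* yᵏ :* y :* Pe :* Pw :* Px₁ :* Px₂ :* Px₃ :* Py₁ :* Py₃)
               := (Iα :* U :* xᵏ :* yᵏ) :* (Py₂′ :* L′ :* Re :* Rw :* Pe :* Pw :* Px₁ :* Px₂ :* Px₃ :* Py₁ :* Py₃ :* y))
               refl Py₂′ (1# - U * y) Re Rw Iα U xᵏ yᵏ y Pe Pw Px₁ Px₂ Px₃ Py₁ Py₃) ⟩
        - 1# * ((Iα * U * xᵏ * yᵏ) * Common)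
          ≈⟨ *-congˡ (*-congʳ monomials) ⟩
        - 1# * (Mono * Common) ∎
        where Rest = Iα * U * xᵏ * yᵏ * y * Pe * Pw * Px₁ * Px₂ * Px₃ * Py₁ * Py₃

      scaled-expansion : V * (term n (2 ℕ.* k) * ((P₁ * poch q z₂ (suc k)) * Px₁ * poch q (q * c / e) k)) ≈ - 1# * (Mono * Common)
      scaled-expansion = begin
        V * (term n (2 ℕ.* k) * ((P₁ * poch q z₂ (suc k)) * Px₁ * poch q (q * c / e) k))
          ≈⟨ *-congˡ (*-cong term-form (*-congˡ Py₁≈)) ⟩
        V * ((Qκ * Y * (Pe * Pw) * (Re * Rw)) * (Px₂ * Py₂′) * ((P₁ * (P₂ * L′)) * Px₁ * Py₁))
          ≈⟨ solve 20 (λ xᵏ yᵏ eᵏ wᵏ Z y U Qκ Y Pe Pw Re Rw Px₂ Py₂′ P₁ P₂ L′ Px₁ Py₁ →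
               (xᵏ :* yᵏ :* eᵏ :* wᵏ :* (Z :* y) :* (U :* y)) :* ((Qκ :* Y :* (Pe :* Pw) :* (Re :* Rw)) :* (Px₂ :* Py₂′) :* ((P₁ :* (P₂ :* L′)) :* Px₁ :* Py₁))
               := (xᵏ :* P₁) :* (yᵏ :* P₂) :* ((U :* y) :* L′) :* (Qκ :* Y :* Pe :* Pw :* Re :* Rw :* Px₂ :* Py₂′ :* Px₁ :* Py₁ :* eᵏ :* wᵏ :* (Z :* y)))
               refl xᵏ yᵏ eᵏ wᵏ Z y U Qκ Y Pe Pw Re Rw Px₂ Py₂′ P₁ P₂ L′ Px₁ Py₁ ⟩
        (xᵏ * P₁) * (yᵏ * P₂) * ((U * y) * L′) * Rest
          ≈⟨ *-congʳ (*-cong (*-cong reverse-x reverse-y) last-factor) ⟩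
        (s * Iβ * Px₃) * (s * Iγ * Py₃) * (- 1# * (1# - U * y)) * Rest
          ≈⟨ solve 21 (λ s Iβ Px₃ Iγ Py₃ U y Qκ Y Pe Pw Re Rw Px₂ Py₂′ Px₁ Py₁ eᵏ wᵏ Z L″ →
               (s :* Iβ :* Px₃) :* (s :* Iγ :* Py₃) :* (:- :1 :* L″) :* (Qκ :* Y :* Pe :* Pw :* Re :* Rw :* Px₂ :* Py₂′ :* Px₁ :* Py₁ :* eᵏ :* wᵏ :* (Z :* y))
               := :- :1 :* ((Qκ :* Y :* (s :* s) :* Iβ :* Iγ :* eᵏ :* wᵏ :* Z) :* (Py₂′ :* L″ :* Re :* Rw :* Pe :* Pw :* Px₁ :* Px₂ :* Px₃ :* Py₁ :* Py₃ :* y)))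
               refl s Iβ Px₃ Iγ Py₃ U y Qκ Y Pe Pw Re Rw Px₂ Py₂′ Px₁ Py₁ eᵏ wᵏ Z (1# - U * y) ⟩
        - 1# * (Mono * Common) ∎
        where Rest = Qκ * Y * Pe * Pw * Re * Rw * Px₂ * Py₂′ * Px₁ * Py₁ * eᵏ * wᵏ * (Z * y)

      V≉0 : ¬ V ≈ 0#
      V≉0 = *-nonzero (*-nonzero (*-nonzero (*-nonzero (*-nonzero (pow-nonzero k x≉0) (pow-nonzero k y≉0)) (pow-nonzero k e≉0)) (pow-nonzero k w≉0))
                                 (*-nonzero (pow-nonzero k q≉0) y≉0))
                      (*-nonzero (pow-nonzero (k ℕ.+ m) q≉0) y≉0)

      cross-multiplied : N * (Pe * Pw) * (Pe′ * Pw′) * (poch q x n * poch q (q * c / e) n)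
                       ≈ term n (2 ℕ.* k) * ((P₁ * poch q z₂ (suc k)) * Px₁ * poch q (q * c / e) k)
      cross-multiplied = *-cancelˡ V≉0 (trans scaled-statement (sym scaled-expansion))

    module Odd (k m : ℕ) where
      n α β γ κ : ℕ
      Z U Px₁ Px₂ Px₃ Py₁ Py₂ Py₃ Pe Pw Pe′ Pw′ Re Rw z₁ z₂ N : Carrier
      n = 2 ℕ.* k ℕ.+ 1 ℕ.+ m
      Z = pow q k
      U = pow q (k ℕ.+ m)
      α = suc k ℕ.* (suc (2 ℕ.* k) ℕ.+ 2 ℕ.* m)
      β = triangle (suc k) ℕ.+ suc k ℕ.* (k ℕ.+ m)
      γ = triangle (suc k) ℕ.+ suc k ℕ.* suc (k ℕ.+ m)
      κ = k ℕ.* k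
      Px₁ = poch q x k
      Px₂ = poch q (Z * x) m
      Px₃ = poch q (U * x) (suc k)
      Py₁ = poch q (q * y) k
      Py₂ = poch q (Z * (q * y)) m
      Py₃ = poch q (pow q (suc (k ℕ.+ m)) * y) (suc k)
      Pe = poch q e (suc k)
      Pw = poch q w (suc k)
      Pe′ = poch q (q / e) k
      Pw′ = poch q (q * c / (a * e)) k
      Re = ρ q e k
      Rw = ρ q w k
      z₁ = zpow q (+ 1 ℤ.- + n) / (a * e)
      z₂ = zpow q (ℤ.- (+ n)) * e / c
      N = (1# - zpow q (ℤ.- (+ k)) / (a * e)) * zpow q ((+ 1 ℤ.+ + k) ℤ.* (+ 1 ℤ.+ + 2 ℤ.* + k ℤ.- + 2 ℤ.* + n))

      n≡k+[m+1+k] : 2 ℕ.* k ℕ.+ 1 ℕ.+ m ≡ k ℕ.+ (m ℕ.+ suc k)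
      n≡k+[m+1+k] = ℕ-solve.solve (k ∷ m ∷ [])
      n≡1+k+[k+m] : 2 ℕ.* k ℕ.+ 1 ℕ.+ m ≡ suc k ℕ.+ (k ℕ.+ m)
      n≡1+k+[k+m] = ℕ-solve.solve (k ∷ m ∷ [])
      1+n≡1+k+[1+k+m] : suc (2 ℕ.* k ℕ.+ 1 ℕ.+ m) ≡ suc k ℕ.+ suc (k ℕ.+ m)
      1+n≡1+k+[1+k+m] = ℕ-solve.solve (k ∷ m ∷ [])
      j≡1+double : 2 ℕ.* k ℕ.+ 1 ≡ suc (double k)
      j≡1+double = ≡.trans (ℕ.+-comm (2 ℕ.* k) 1) (≡.cong suc (≡.sym (double≡2* k)))

      numerator : N ≈ (1# - pow q⁻¹ k * x′) * pow q⁻¹ α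
      numerator = *-cong (+-congˡ (-‿cong (*-congʳ (zpow-neg k))))
                         (trans (≡⇒≈ (≡.cong (zpow q) (odd-exponent k m))) (zpow-neg α))

      split-x : poch q x n ≈ Px₁ * (Px₂ * Px₃)
      split-x = trans (≡⇒≈ (≡.cong (poch q x) n≡k+[m+1+k])) (poch-+₃ q x k m (suc k))

      split-y : poch q (q * c / e) n ≈ Py₁ * (Py₂ * Py₃)
      split-y = trans (poch-cong q n (*-assoc q c (e ⁻¹))) (trans (≡⇒≈ (≡.cong (poch q (q * y)) n≡k+[m+1+k]))
        (trans (poch-+₃ q (q * y) k m (suc k)) (*-congˡ (*-congˡ (poch-cong q (suc k)
          (solve 3 (λ p q y → p :* (q :* y) := q :* p :* y) refl (pow q (k ℕ.+ m)) q y))))))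

      reverse-x : pow x (suc k) * poch q z₁ (suc k) ≈ sign (suc k) * pow q⁻¹ β * Px₃
      reverse-x = trans (*-congˡ (poch-cong q (suc k) z₁≈)) (poch-reverse xx′≈1 (suc k) (k ℕ.+ m))
        where
        z₁≈ : z₁ ≈ pow q⁻¹ (suc k ℕ.+ (k ℕ.+ m)) * (q * x′)
        z₁≈ = trans (*-congʳ (zpow-1-n n)) (trans (solve 3 (λ q p x′ → q :* p :* x′ := p :* (q :* x′)) refl q (pow q⁻¹ n) x′)
                    (*-congʳ (≡⇒≈ (≡.cong (pow q⁻¹) n≡1+k+[k+m]))))

      reverse-y : pow y (suc k) * poch q z₂ (suc k) ≈ sign (suc k) * pow q⁻¹ γ * Py₃
      reverse-y = trans (*-congˡ (poch-cong q (suc k) z₂≈)) (poch-reverse yy′≈1 (suc k) (suc (k ℕ.+ m)))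
        where
        z₂≈ : z₂ ≈ pow q⁻¹ (suc k ℕ.+ suc (k ℕ.+ m)) * (q * y′)
        z₂≈ = begin
          z₂                                   ≈⟨ trans (*-congʳ (*-congʳ (zpow-neg n))) (*-assoc _ _ _) ⟩
          pow q⁻¹ n * y′                       ≈⟨ *-unitʳ _ (⁻¹-inverseˡ q≉0) ⟨
          pow q⁻¹ n * y′ * (q⁻¹ * q)           ≈⟨ solve 4 (λ p y′ i q → p :* y′ :* (i :* q) := i :* p :* (q :* y′)) refl (pow q⁻¹ n) y′ q⁻¹ q ⟩
          pow q⁻¹ (suc n) * (q * y′)           ≡⟨ ≡.cong (λ i → pow q⁻¹ i * (q * y′)) 1+n≡1+k+[1+k+m] ⟩
          pow q⁻¹ (suc k ℕ.+ suc (k ℕ.+ m)) * (q * y′) ∎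

      first-factor : (Z * x) * (1# - pow q⁻¹ k * x′) ≈ - 1# * (1# - Z * x)
      first-factor = flip-factor (*-inverse (pow-q⁻¹ k) xx′≈1)

      term-form : term n (2 ℕ.* k ℕ.+ 1) ≈ (pow q κ * pow y (suc (double k)) * (Pe * Pw) * (Re * Rw)) * (Px₂ * Py₂)
      term-form = begin
        term n (2 ℕ.* k ℕ.+ 1)                         ≡⟨ ≡.cong₂ term (≡.cong (ℕ._+ m) j≡1+double) j≡1+double ⟩
        term (suc (double k) ℕ.+ m) (suc (double k))   ≡⟨ ≡.trans (term-odd k m) (≡.cong (_* (poch q (Z * X) m * poch q (pow q (suc k) * y) m)) (coeff-odd k)) ⟩
        (pow q κ * pow y (suc (double k)) * (Pe * Pw) * (Re * Rw)) * (poch q (Z * X) m * poch q (pow q (suc k) * y) m)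
          ≈⟨ *-congˡ (*-cong (poch-cong q m (*-congˡ X≈x)) (poch-cong q m (solve 3 (λ q Z y → q :* Z :* y := Z :* (q :* y)) refl q Z y))) ⟩
        (pow q κ * pow y (suc (double k)) * (Pe * Pw) * (Re * Rw)) * (Px₂ * Py₂) ∎

      xᵏ⁺¹ yᵏ⁺¹ eᵏ wᵏ Y Iα Iβ Iγ Qκ s P₁ P₂ L Mono : Carrier
      xᵏ⁺¹ = pow x (suc k) ; yᵏ⁺¹ = pow y (suc k) ; eᵏ = pow e k ; wᵏ = pow w k
      Y = pow y (suc (double k))
      Iα = pow q⁻¹ α ; Iβ = pow q⁻¹ β ; Iγ = pow q⁻¹ γ ; Qκ = pow q κ ; s = sign (suc k)
      P₁ = poch q z₁ (suc k) ; P₂ = poch q z₂ (suc k)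
      L = 1# - pow q⁻¹ k * x′

      Mono = Qκ * Y * (s * s) * Iβ * Iγ * eᵏ * wᵏ * (Z * x)

      monomials : Iα * xᵏ⁺¹ * yᵏ⁺¹ ≈ Mono
      monomials = begin
        Iα * (x * pow x k) * (y * pow y k)
          ≈⟨ *-congʳ (*-congˡ (*-congˡ (trans (pow-cong k (sym X≈x)) (trans (pow-distrib-* (w * e) y k) (*-congʳ (pow-distrib-* w e k)))))) ⟩
        Iα * (x * (wᵏ * eᵏ * pow y k)) * (y * pow y k)
          ≈⟨ solve 6 (λ a x w e y yk → a :* (x :* (w :* e :* yk)) :* (y :* yk) := (a :* :1) :* (x :* w :* e :* yk :* y :* yk)) refl Iα x wᵏ eᵏ y (pow y k) ⟩
        (Iα * pow q 0) * (x * wᵏ * eᵏ * pow y k * y * pow y k)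
          ≈⟨ *-congʳ (exponent-balance α (β ℕ.+ γ) 0 (κ ℕ.+ k) balance) ⟩
        (pow q⁻¹ (β ℕ.+ γ) * pow q (κ ℕ.+ k)) * (x * wᵏ * eᵏ * pow y k * y * pow y k)
          ≈⟨ *-congʳ (*-cong (pow-+ q⁻¹ β γ) (pow-+ q κ k)) ⟩
        ((Iβ * Iγ) * (Qκ * Z)) * (x * wᵏ * eᵏ * pow y k * y * pow y k)
          ≈⟨ solve 9 (λ b c p z x w e yk y → ((b :* c) :* (p :* z)) :* (x :* w :* e :* yk :* y :* yk) := p :* (y :* (yk :* yk)) :* :1 :* b :* c :* e :* w :* (z :* x)) refl
               Iβ Iγ Qκ Z x wᵏ eᵏ (pow y k) y ⟩
        Qκ * (y * (pow y k * pow y k)) * 1# * Iβ * Iγ * eᵏ * wᵏ * (Z * x)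
          ≈⟨ *-congʳ (*-congʳ (*-congʳ (*-congʳ (*-congʳ (*-cong (*-congˡ (*-congˡ (pow-double y k))) (sign² (suc k))))))) ⟨
        Mono ∎
        where
        balance : α ℕ.+ (κ ℕ.+ k) ≡ (β ℕ.+ γ) ℕ.+ 0
        balance = ≡.trans (≡.cong (α ℕ.+_) (≡.trans (ℕ.+-comm κ k) (≡.sym (triangle-double (suc k))))) (identity k m (triangle (suc k)))
          where
          identity : ∀ k m t → suc k ℕ.* (suc (2 ℕ.* k) ℕ.+ 2 ℕ.* m) ℕ.+ (t ℕ.+ t)
                             ≡ (t ℕ.+ suc k ℕ.* (k ℕ.+ m) ℕ.+ (t ℕ.+ suc k ℕ.* suc (k ℕ.+ m))) ℕ.+ 0
          identity = ℕ-solve.solve-∀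

      V Common : Carrier
      V = xᵏ⁺¹ * yᵏ⁺¹ * eᵏ * wᵏ * (Z * x)
      Common = (1# - Z * x) * Re * Rw * Pe * Pw * Px₁ * Px₂ * Px₃ * Py₁ * Py₂ * Py₃

      ρ-w : wᵏ * Pw′ ≈ Rw
      ρ-w = trans (*-congˡ (poch-cong q k (*-assoc q c x′))) (ρ-pow-poch q ww′≈1 k)

      scaled-statement : V * (N * (Pe * Pw) * (Pe′ * Pw′) * (poch q x n * poch q (q * c / e) n)) ≈ - 1# * (Mono * Common)
      scaled-statement = begin
        V * (N * (Pe * Pw) * (Pe′ * Pw′) * (poch q x n * poch q (q * c / e) n))
          ≈⟨ *-congˡ (*-cong (*-congʳ (*-congʳ numerator)) (*-cong split-x split-y)) ⟩
        V * ((L * Iα) * (Pe * Pw) * (Pe′ * Pw′) * ((Px₁ * (Px₂ * Px₃)) * (Py₁ * (Py₂ * Py₃))))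
          ≈⟨ solve 18 (λ xᵏ⁺¹ yᵏ⁺¹ eᵏ wᵏ Z x L Iα Pe Pw Pe′ Pw′ Px₁ Px₂ Px₃ Py₁ Py₂ Py₃ →
               (xᵏ⁺¹ :* yᵏ⁺¹ :* eᵏ :* wᵏ :* (Z :* x)) :* ((L :* Iα) :* (Pe :* Pw) :* (Pe′ :* Pw′) :* ((Px₁ :* (Px₂ :* Px₃)) :* (Py₁ :* (Py₂ :* Py₃))))
               := ((Z :* x) :* L) :* (eᵏ :* Pe′) :* (wᵏ :* Pw′) :* (Iα :* xᵏ⁺¹ :* yᵏ⁺¹ :* Pe :* Pw :* Px₁ :* Px₂ :* Px₃ :* Py₁ :* Py₂ :* Py₃))
               refl xᵏ⁺¹ yᵏ⁺¹ eᵏ wᵏ Z x L Iα Pe Pw Pe′ Pw′ Px₁ Px₂ Px₃ Py₁ Py₂ Py₃ ⟩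
        ((Z * x) * L) * (eᵏ * Pe′) * (wᵏ * Pw′) * Rest
          ≈⟨ *-congʳ (*-cong (*-cong first-factor (ρ-pow-poch q ee′≈1 k)) ρ-w) ⟩
        (- 1# * (1# - Z * x)) * Re * Rw * Rest
          ≈⟨ solve 14 (λ L′ Re Rw Iα xᵏ⁺¹ yᵏ⁺¹ Pe Pw Px₁ Px₂ Px₃ Py₁ Py₂ Py₃ →
               (:- :1 :* L′) :* Re :* Rw :* (Iα :* xᵏ⁺¹ :* yᵏ⁺¹ :* Pe :* Pw :* Px₁ :* Px₂ :* Px₃ :* Py₁ :* Py₂ :* Py₃)
               := :- :1 :* ((Iα :* xᵏ⁺¹ :* yᵏ⁺¹) :* (L′ :* Re :* Rw :* Pe :* Pw :* Px₁ :* Px₂ :* Px₃ :* Py₁ :* Py₂ :* Py₃)))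
               refl (1# - Z * x) Re Rw Iα xᵏ⁺¹ yᵏ⁺¹ Pe Pw Px₁ Px₂ Px₃ Py₁ Py₂ Py₃ ⟩
        - 1# * ((Iα * xᵏ⁺¹ * yᵏ⁺¹) * Common)
          ≈⟨ *-congˡ (*-congʳ monomials) ⟩
        - 1# * (Mono * Common) ∎
        where Rest = Iα * xᵏ⁺¹ * yᵏ⁺¹ * Pe * Pw * Px₁ * Px₂ * Px₃ * Py₁ * Py₂ * Py₃

      scaled-expansion : V * (- term n (2 ℕ.* k ℕ.+ 1) * ((P₁ * P₂) * poch q x (suc k) * poch q (q * c / e) k)) ≈ - 1# * (Mono * Common)
      scaled-expansion = begin
        V * (- term n (2 ℕ.* k ℕ.+ 1) * ((P₁ * P₂) * poch q x (suc k) * poch q (q * c / e) k))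
          ≈⟨ *-congˡ (*-cong (trans (-‿cong term-form) (sym (-1*x≈-x _))) (*-congˡ (poch-cong q k (*-assoc q c (e ⁻¹))))) ⟩
        V * ((- 1# * ((Qκ * Y * (Pe * Pw) * (Re * Rw)) * (Px₂ * Py₂))) * ((P₁ * P₂) * (Px₁ * (1# - Z * x)) * Py₁))
          ≈⟨ solve 19 (λ xᵏ⁺¹ yᵏ⁺¹ eᵏ wᵏ Z x Qκ Y Pe Pw Re Rw Px₂ Py₂ P₁ P₂ Px₁ Py₁ L′ →
               (xᵏ⁺¹ :* yᵏ⁺¹ :* eᵏ :* wᵏ :* (Z :* x)) :* ((:- :1 :* ((Qκ :* Y :* (Pe :* Pw) :* (Re :* Rw)) :* (Px₂ :* Py₂))) :* ((P₁ :* P₂) :* (Px₁ :* L′) :* Py₁))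
               := (xᵏ⁺¹ :* P₁) :* (yᵏ⁺¹ :* P₂) :* (:- :1 :* Qκ :* Y :* Pe :* Pw :* Re :* Rw :* Px₂ :* Py₂ :* Px₁ :* L′ :* Py₁ :* eᵏ :* wᵏ :* (Z :* x)))
               refl xᵏ⁺¹ yᵏ⁺¹ eᵏ wᵏ Z x Qκ Y Pe Pw Re Rw Px₂ Py₂ P₁ P₂ Px₁ Py₁ (1# - Z * x) ⟩
        (xᵏ⁺¹ * P₁) * (yᵏ⁺¹ * P₂) * Rest
          ≈⟨ *-congʳ (*-cong reverse-x reverse-y) ⟩
        (s * Iβ * Px₃) * (s * Iγ * Py₃) * Rest
          ≈⟨ solve 20 (λ s Iβ Px₃ Iγ Py₃ Qκ Y Pe Pw Re Rw Px₂ Py₂ Px₁ L′ Py₁ eᵏ wᵏ Z x →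
               (s :* Iβ :* Px₃) :* (s :* Iγ :* Py₃) :* (:- :1 :* Qκ :* Y :* Pe :* Pw :* Re :* Rw :* Px₂ :* Py₂ :* Px₁ :* L′ :* Py₁ :* eᵏ :* wᵏ :* (Z :* x))
               := :- :1 :* ((Qκ :* Y :* (s :* s) :* Iβ :* Iγ :* eᵏ :* wᵏ :* (Z :* x)) :* (L′ :* Re :* Rw :* Pe :* Pw :* Px₁ :* Px₂ :* Px₃ :* Py₁ :* Py₂ :* Py₃)))
               refl s Iβ Px₃ Iγ Py₃ Qκ Y Pe Pw Re Rw Px₂ Py₂ Px₁ (1# - Z * x) Py₁ eᵏ wᵏ Z x ⟩
        - 1# * (Mono * Common) ∎
        where Rest = - 1# * Qκ * Y * Pe * Pw * Re * Rw * Px₂ * Py₂ * Px₁ * (1# - Z * x) * Py₁ * eᵏ * wᵏ * (Z * x)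

      V≉0 : ¬ V ≈ 0#
      V≉0 = *-nonzero (*-nonzero (*-nonzero (*-nonzero (pow-nonzero (suc k) x≉0) (pow-nonzero (suc k) y≉0)) (pow-nonzero k e≉0)) (pow-nonzero k w≉0))
                      (*-nonzero (pow-nonzero k q≉0) x≉0)

      cross-multiplied : N * (Pe * Pw) * (Pe′ * Pw′) * (poch q x n * poch q (q * c / e) n)
                       ≈ - term n (2 ℕ.* k ℕ.+ 1) * ((P₁ * P₂) * poch q x (suc k) * poch q (q * c / e) k)
      cross-multiplied = *-cancelˡ V≉0 (trans scaled-statement (sym scaled-expansion))

    Dx Dy : ℕ → Carrier
    Dx n = poch q (a * e) n
    Dy n = poch q (q * c / e) n

    even-summand odd-summand : ℕ → ℕ → Carrier
    even-summand n k = gauss q n (2 ℕ.* k)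
      * ((1# - zpow q (ℤ.- (+ k)) * e / c)
         * zpow q ((+ 1 ℤ.+ + 2 ℤ.* + k) ℤ.* (+ k ℤ.- + n))
         / (poch q (zpow q (+ 1 ℤ.- + n) / (a * e)) k
            * poch q (zpow q (ℤ.- (+ n)) * e / c) (suc k)))
      * (poch q e k * poch q (a * e / c) k / poch q (a * e) k)
      * (poch q (q / e) k * poch q (q * c / (a * e)) k / poch q (q * c / e) k)
    odd-summand n k = gauss q n (2 ℕ.* k ℕ.+ 1)
      * ((1# - zpow q (ℤ.- (+ k)) / (a * e))
         * zpow q ((+ 1 ℤ.+ + k) ℤ.* (+ 1 ℤ.+ + 2 ℤ.* + k ℤ.- + 2 ℤ.* + n))
         / (poch q (zpow q (+ 1 ℤ.- + n) / (a * e)) (suc k)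
            * poch q (zpow q (ℤ.- (+ n)) * e / c) (suc k)))
      * (poch q e (suc k) * poch q (a * e / c) (suc k) / poch q (a * e) (suc k))
      * (poch q (q / e) k * poch q (q * c / (a * e)) k / poch q (q * c / e) k)

    EvenDenominators OddDenominators : ℕ → ℕ → Set ℓ
    EvenDenominators n k =
      ¬ (poch q (zpow q (+ 1 ℤ.- + n) / (a * e)) k ≈ 0#) ×
      ¬ (poch q (zpow q (ℤ.- (+ n)) * e / c) (suc k) ≈ 0#) ×
      ¬ (poch q (a * e) k ≈ 0#) ×
      ¬ (poch q (q * c / e) k ≈ 0#)
    OddDenominators n k =
      ¬ (poch q (zpow q (+ 1 ℤ.- + n) / (a * e)) (suc k) ≈ 0#) ×
      ¬ (poch q (zpow q (ℤ.- (+ n)) * e / c) (suc k) ≈ 0#) ×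
      ¬ (poch q (a * e) (suc k) ≈ 0#) ×
      ¬ (poch q (q * c / e) k ≈ 0#)

    expansion-summand : ℕ → ℕ → Carrier
    expansion-summand n j = gauss q n j * term n j / (Dx n * Dy n)

    even-summand-matches : ∀ {n} k m → 2 ℕ.* k ℕ.+ m ≡ n → ¬ Dx n ≈ 0# → ¬ Dy n ≈ 0# →
      EvenDenominators n k → even-summand n k ≈ expansion-summand n (2 ℕ.* k)
    even-summand-matches k m ≡.refl Dx≉0 Dy≉0 (d₁≉0 , d₂≉0 , d₃≉0 , d₄≉0) =
      fraction-product _ _ _ _ _ (*-nonzero d₁≉0 d₂≉0) d₃≉0 d₄≉0 (*-nonzero Dx≉0 Dy≉0) (Even.cross-multiplied k m)

    odd-summand-matches : ∀ {n} k m → 2 ℕ.* k ℕ.+ 1 ℕ.+ m ≡ n → ¬ Dx n ≈ 0# → ¬ Dy n ≈ 0# →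
      OddDenominators n k → odd-summand n k ≈ - expansion-summand n (2 ℕ.* k ℕ.+ 1)
    odd-summand-matches k m ≡.refl Dx≉0 Dy≉0 (d₁≉0 , d₂≉0 , d₃≉0 , d₄≉0) =
      trans (fraction-product _ _ _ _ _ (*-nonzero d₁≉0 d₂≉0) d₃≉0 d₄≉0 (*-nonzero Dx≉0 Dy≉0) (Odd.cross-multiplied k m))
            (solve 3 (λ g F D → g :* (:- F) :* D := :- (g :* F :* D)) refl _ _ _)

    summation : ∀ n → ¬ Dx n ≈ 0# → ¬ Dy n ≈ 0# →
      (∀ k → 2 ℕ.* k ≤ n → EvenDenominators n k) → (∀ k → 2 ℕ.* k ℕ.+ 1 ≤ n → OddDenominators n k) →
      poch q a n * poch q c n / (Dx n * Dy n) ≈ sumTo (suc n) (even-summand n) - sumTo (suc n) (odd-summand n)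
    summation n Dx≉0 Dy≉0 even-ok odd-ok = begin
      poch q a n * poch q c n * D⁻¹
        ≈⟨ *-congʳ (*-cong (poch-cong q n (sym wy≈a)) (poch-cong q n (sym ey≈c))) ⟩
      poch q (w * y) n * poch q (e * y) n * D⁻¹
        ≈⟨ *-congʳ (expansion n) ⟩
      sumTo (suc n) (λ j → gauss q n j * term n j) * D⁻¹
        ≈⟨ sumTo-*ʳ (suc n) D⁻¹ _ ⟨
      sumTo (suc n) (expansion-summand n)
        ≈⟨ sumTo-vanishing-tail (suc n) (suc n ℕ.+ 0) (expansion-summand n) (λ j n<j → ≈0⇒*≈0 D⁻¹ (≈0⇒*≈0 (term n j) (gauss-vanishes q n<j))) ⟨
      sumTo (2 ℕ.* suc n) (expansion-summand n)
        ≈⟨ sumTo-pairs (suc n) (expansion-summand n) ⟨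
      sumTo (suc n) (λ k → expansion-summand n (2 ℕ.* k) + expansion-summand n (2 ℕ.* k ℕ.+ 1))
        ≈⟨ sumTo-cong (suc n) (λ k _ → pair k) ⟩
      sumTo (suc n) (λ k → even-summand n k - odd-summand n k)
        ≈⟨ sumTo-sub (suc n) (even-summand n) (odd-summand n) ⟩
      sumTo (suc n) (even-summand n) - sumTo (suc n) (odd-summand n) ∎
      where
      D⁻¹ = (Dx n * Dy n) ⁻¹
      even-matches : ∀ k → even-summand n k ≈ expansion-summand n (2 ℕ.* k)
      even-matches k with 2 ℕ.* k ℕ.≤? n
      ... | yes 2k≤n = even-summand-matches k (n ∸ 2 ℕ.* k) (ℕ.m+[n∸m]≡n 2k≤n) Dx≉0 Dy≉0 (even-ok k 2k≤n)
      ... | no 2k≰n  = trans (≈0⇒*≈0 _ (≈0⇒*≈0 _ (≈0⇒*≈0 _ g≈0))) (sym (≈0⇒*≈0 _ (≈0⇒*≈0 _ g≈0)))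
        where g≈0 = gauss-vanishes q (ℕ.≰⇒> 2k≰n)
      odd-matches : ∀ k → odd-summand n k ≈ - expansion-summand n (2 ℕ.* k ℕ.+ 1)
      odd-matches k with 2 ℕ.* k ℕ.+ 1 ℕ.≤? n
      ... | yes 2k+1≤n = odd-summand-matches k (n ∸ (2 ℕ.* k ℕ.+ 1)) (ℕ.m+[n∸m]≡n 2k+1≤n) Dx≉0 Dy≉0 (odd-ok k 2k+1≤n)
      ... | no 2k+1≰n  = trans (≈0⇒*≈0 _ (≈0⇒*≈0 _ (≈0⇒*≈0 _ g≈0))) (sym (trans (-‿cong (≈0⇒*≈0 _ (≈0⇒*≈0 _ g≈0))) -0#≈0#))
        where g≈0 = gauss-vanishes q (ℕ.≰⇒> 2k+1≰n)
      pair : ∀ k → expansion-summand n (2 ℕ.* k) + expansion-summand n (2 ℕ.* k ℕ.+ 1) ≈ even-summand n k - odd-summand n k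
      pair k = sym (trans (+-cong (even-matches k) (-‿cong (odd-matches k))) (+-congˡ (-‿involutive _)))

proposition1 : {c ℓ : Level} (F : Field c ℓ) →
  let open Field F in let open FieldOps F in
  (n : ℕ) (q a c e : Carrier) →
  ¬ (q ≈ 0#) → ¬ (a ≈ 0#) → ¬ (c ≈ 0#) → ¬ (e ≈ 0#) →
  ¬ (poch q (a * e) n ≈ 0#) →
  ¬ (poch q (q * c / e) n ≈ 0#) →
  (∀ k → 2 ℕ.* k ≤ n →
    ¬ (poch q (zpow q (+ 1 ℤ.- + n) / (a * e)) k ≈ 0#) ×
    ¬ (poch q (zpow q (ℤ.- (+ n)) * e / c) (suc k) ≈ 0#) ×
    ¬ (poch q (a * e) k ≈ 0#) ×
    ¬ (poch q (q * c / e) k ≈ 0#)) →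
  (∀ k → 2 ℕ.* k ℕ.+ 1 ≤ n →
    ¬ (poch q (zpow q (+ 1 ℤ.- + n) / (a * e)) (suc k) ≈ 0#) ×
    ¬ (poch q (zpow q (ℤ.- (+ n)) * e / c) (suc k) ≈ 0#) ×
    ¬ (poch q (a * e) (suc k) ≈ 0#) ×
    ¬ (poch q (q * c / e) k ≈ 0#)) →
  poch q a n * poch q c n / (poch q (a * e) n * poch q (q * c / e) n)
    ≈ sumTo (suc n) (λ k →
        gauss q n (2 ℕ.* k)
        * ((1# - zpow q (ℤ.- (+ k)) * e / c)
           * zpow q ((+ 1 ℤ.+ + 2 ℤ.* + k) ℤ.* (+ k ℤ.- + n))
           / (poch q (zpow q (+ 1 ℤ.- + n) / (a * e)) k
              * poch q (zpow q (ℤ.- (+ n)) * e / c) (suc k)))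
        * (poch q e k * poch q (a * e / c) k / poch q (a * e) k)
        * (poch q (q / e) k * poch q (q * c / (a * e)) k / poch q (q * c / e) k))
      - sumTo (suc n) (λ k →
        gauss q n (2 ℕ.* k ℕ.+ 1)
        * ((1# - zpow q (ℤ.- (+ k)) / (a * e))
           * zpow q ((+ 1 ℤ.+ + k) ℤ.* (+ 1 ℤ.+ + 2 ℤ.* + k ℤ.- + 2 ℤ.* + n))
           / (poch q (zpow q (+ 1 ℤ.- + n) / (a * e)) (suc k)
              * poch q (zpow q (ℤ.- (+ n)) * e / c) (suc k)))
        * (poch q e (suc k) * poch q (a * e / c) (suc k) / poch q (a * e) (suc k))
        * (poch q (q / e) k * poch q (q * c / (a * e)) k / poch q (q * c / e) k))
proposition1 F n q a c e q≉0 a≉0 c≉0 e≉0 =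
  QSeries.Matching.summation F q a c e q≉0 a≉0 c≉0 e≉0 n
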